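{- Let $M_1,\dots,M_n$ be positive integers with sum $Z$, and let $\mathbf{p}=(M_1/Z,\dots,M_n/Z)$. Then any exact entropy-optimal sampler whose output distribution is $\mathbf{p}$ needs at most $Z-1$ bits of precision; that is, there is an entropy-optimal DDG tree with output distribution exactly $\mathbf{p}$ that uses at most $Z-1$ bits of precision.
   Context: Random bit model: a source supplies independent fair bits. A sampler is described by its discrete distribution generating (DDG) tree $T=(S,r,n,c,\delta)$: $S\subseteq\mathbb{N}$ a set of nodes, $r\in S$ the root, $c:S\to\{1,\dots,n\}\cup\{\mathsf{branch}\}$ labels nodes as branch nodes or leaves labelled by outcomes, $\delta:S\times\{0,1\}\to S$ the transition function. Sampling starts at $r$; at a branch node a fresh fair bit $b$ is drawn and the sampler moves to $\delta(\text{node},b)$; at a leaf labelled $i$ it outputs $i$. $\delta$ may contain back-edges (so a finite $S$ may encode an infinite tree). The output distribution is $(p_1,\dots,p_n)$ with $p_i$ the probability of halting with output $i$; a sampler is exact for $\mathbf{p}$ if its output distribution equals $\mathbf{p}$. $T$ is entropy-optimal if its expected number of consumed bits is minimal among all DDG trees with the same output distribution. $T$ uses $k$ bits of precision if $S$ is finite and the longest simple path through $\delta$ from $r$ to any leaf has exactly $k$ edges. -}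

module Defs where

open import Data.Nat as ℕ using (ℕ; zero; suc; _≤_; NonZero; _^_)
open import Data.Nat.Properties using (m^n≢0)
open import Data.Integer using (+_)
open import Data.Rational as ℚ using (ℚ; 0ℚ; _/_; ∣_∣; _-_)
open import Data.Fin as Fin using (Fin; inject₁; fromℕ)
open import Data.Bool using (Bool; true; false)
open import Data.List using (List; []; _∷_; map; _++_)
open import Data.Vec as Vec using (Vec; tabulate)
open import Data.Product using (Σ; ∃; ∃-syntax; _×_)
open import Relation.Binary.PropositionalEquality using (_≡_)
open import Relation.Nullary using (yes; no)

data Label (n : ℕ) : Set where
  branch : Label n
  leaf   : Fin n → Label n

-- A DDG tree (S, r, n, c, δ) with node set given by a type N.
-- General trees (S ⊆ ℕ, possibly infinite) use N = ℕ; finite ones N = Fin m.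
record DDG (N : Set) (n : ℕ) : Set where
  field
    root : N
    c    : N → Label n
    δ    : N → Bool → N
open DDG public

data Result (n : ℕ) : Set where
  halted  : Fin n → Result n
  running : Result n

walk : ∀ {N n} → DDG N n → N → List Bool → Result n
walk T s w with c T s
... | leaf i = halted i
walk T s [] | branch = running
walk T s (b ∷ w) | branch = walk T (δ T s b) w

allBits : ℕ → List (List Bool)
allBits zero = [] ∷ []
allBits (suc k) = map (true ∷_) (allBits k) ++ map (false ∷_) (allBits k)

sumL : List ℕ → ℕ
sumL [] = 0
sumL (x ∷ xs) = x ℕ.+ sumL xs

isHalt : ∀ {n} → Fin n → Result n → ℕ
isHalt i (halted j) with i Fin.≟ j
... | yes _ = 1
... | no _  = 0
isHalt i running = 0

isRunning : ∀ {n} → Result n → ℕ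
isRunning (halted _) = 0
isRunning running = 1

haltCount : ∀ {N n} → DDG N n → Fin n → ℕ → ℕ
haltCount T i k = sumL (map (λ w → isHalt i (walk T (root T) w)) (allBits k))

runCount : ∀ {N n} → DDG N n → ℕ → ℕ
runCount T k = sumL (map (λ w → isRunning (walk T (root T) w)) (allBits k))

over2^ : ℕ → ℕ → ℚ
over2^ x k = _/_ (+ x) (2 ^ k) {{m^n≢0 2 k}}

haltProb : ∀ {N n} → DDG N n → Fin n → ℕ → ℚ
haltProb T i k = over2^ (haltCount T i k) k

Converges : (ℕ → ℚ) → ℚ → Set
Converges f L = ∀ (ε : ℚ) → 0ℚ ℚ.< ε → ∃[ K ] (∀ k → K ≤ k → ∣ f k - L ∣ ℚ.< ε)

ExactFor : ∀ {N n} → DDG N n → (Fin n → ℚ) → Set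
ExactFor {n = n} T p = ∀ (i : Fin n) → Converges (haltProb T i) (p i)

-- partial sums of E[#bits] = Σ_{k ≥ 0} P(still at a branch node after k bits)
expBitsPartial : ∀ {N n} → DDG N n → ℕ → ℚ
expBitsPartial T zero = 0ℚ
expBitsPartial T (suc K) = expBitsPartial T K ℚ.+ over2^ (runCount T K) K

-- sup f ≤ sup g in [0, ∞] (used for nondecreasing partial-sum sequences)
SupLeq : (ℕ → ℚ) → (ℕ → ℚ) → Set
SupLeq f g = ∀ (K : ℕ) (ε : ℚ) → 0ℚ ℚ.< ε → ∃[ K' ] (f K ℚ.≤ g K' ℚ.+ ε)

ExpBitsLeq : ∀ {N N' n} → DDG N n → DDG N' n → Set
ExpBitsLeq T T' = SupLeq (expBitsPartial T) (expBitsPartial T')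

EntropyOptimal : ∀ {N n} → DDG N n → (Fin n → ℚ) → Set
EntropyOptimal {n = n} T p = ∀ (T' : DDG ℕ n) → ExactFor T' p → ExpBitsLeq T T'

data IsBranch {n : ℕ} : Label n → Set where
  isBranch : IsBranch branch

record SimpleLeafPath {N n} (T : DDG N n) (k : ℕ) : Set where
  field
    v        : Fin (suc k) → N
    starts   : v Fin.zero ≡ root T
    steps    : ∀ (j : Fin k) → IsBranch (c T (v (inject₁ j))) ×
                                 ∃[ b ] (δ T (v (inject₁ j)) b ≡ v (Fin.suc j))
    endsLeaf : ∃[ i ] (c T (v (fromℕ k)) ≡ leaf i)
    simple   : ∀ a b → v a ≡ v b → a ≡ b

UsesPrecision : ∀ {m n} → DDG (Fin m) n → ℕ → Set
UsesPrecision T k = SimpleLeafPath T k × (∀ k' → SimpleLeafPath T k' → k' ℕ.≤ k)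

total : ∀ {n} → (Fin n → ℕ) → ℕ
total M = Vec.sum (tabulate M)

target : ∀ {n} (M : Fin n → ℕ) → .{{NonZero (total M)}} → Fin n → ℚ
target M i = (+ M i) / total M

module Submission where

-- A sampler that, for every k, has halted with output i on exactly ⌊2^k M_i / Z⌋ of the 2^k strings of
-- length k is exact, and it is entropy optimal: an exact sampler can never have halted more often, so
-- at every depth this one is still running on the fewest strings.  Such a sampler is built level by
-- level: level ℓ has width ℓ = 2^ℓ - Σ_i ⌊2^ℓ M_i / Z⌋ branch nodes, and their 2 · width ℓ children are
-- the branch nodes of the next level followed by ⌊2 r_i / Z⌋ leaves labelled i, where r_i = 2^ℓ M_i mod Z.
-- Writing Z = 2^s Z′ with Z′ odd and taking T < Z′ with Z′ ∣ 2^T - 1, the remainders r_i repeat with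
-- period T from level s on, so level s + T can be identified with level s and the tree is finite.  A
-- simple path visits level s at the depths s, s + T, s + 2T, …, each time in a different one of its
-- width s ≤ 2^s nodes, so it has at most s + width s · T ≤ Z - 1 edges (width s = 0 when Z′ = 1).

open import Defs
open import Data.Bool using (Bool; true; false)
open import Data.Empty using (⊥-elim)
open import Data.Fin as Fin using (Fin; toℕ; fromℕ<; inject₁; fromℕ; combine; remQuot; splitAt; _↑ˡ_; _↑ʳ_)
import Data.Fin.Properties as FinP
open import Data.Fin.Induction using (<-weakInduction)
open import Data.Fin.Subset.Properties using (anySubset?)
open import Data.Integer as ℤ using (_⊖_)
import Data.Integer.Properties as ℤP
open import Data.List using (List; []; _∷_; map; _++_)
import Data.List.Properties as List
open import Data.Nat as ℕ using (ℕ; zero; suc; _+_; _*_; _^_; _≤_; _<_; _∸_; z≤n; s≤s; NonZero; _/_; _%_)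
import Data.Nat.Properties as ℕP
open import Algebra.Properties.CommutativeSemigroup ℕP.+-commutativeSemigroup using (interchange)
open import Algebra.Properties.Semiring.Sum ℕP.+-*-semiring
  using (sum; sum-syntax; sum-cong-≗; ∑-distrib-+; *-distribˡ-sum; *-distribʳ-sum; sum-replicate-zero; sum-remove)
import Data.Nat.DivMod as ℕ
open import Data.Nat.DivMod using (_mod_)
open import Data.Nat.Coprimality using (Coprime; coprime-divisor)
open import Data.Nat.Divisibility
  using (_∣_; divides; ∣-refl; ∣-trans; ∣1⇒≡1; ∣m+n∣m⇒∣n; m∣m*n; n∣m*n; ∣m⇒∣m*n; *-monoʳ-∣; m%n≡0⇒n∣m; n∣m⇒m%n≡0)
open import Data.Nat.GeneralisedArithmetic using (fold; fold-+)
open import Data.Nat.Induction using (<-wellFounded)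
open import Data.Product using (Σ; ∃; ∃-syntax; _×_; _,_; proj₁; proj₂)
import Data.Rational as ℚ
open import Data.Rational using (0ℚ; mkℚ; toℚᵘ)
import Data.Rational.Properties as ℚP
open import Data.Rational.Unnormalised as ℚᵘ using (mkℚᵘ; *<*; *≤*)
import Data.Rational.Unnormalised.Properties as ℚᵘP
open import Data.Sum using (_⊎_; inj₁; inj₂; [_,_]′)
open import Data.Unit using (⊤; tt)
open import Data.Vec using (Vec; []; _∷_; tabulate)
open import Data.Vec.Functional using (removeAt)
open import Function using (_∘_)
open import Induction.WellFounded using (Acc; acc)
open import Relation.Binary using (tri<; tri≈; tri>)
open import Relation.Binary.PropositionalEquality
open import Relation.Nullary using (Dec; yes; no; ¬_)
open import Relation.Nullary.Decidable using (map′; _×-dec_; _→-dec_)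
open import Relation.Unary using (Decidable)

-- Powers of two and the period of 2 modulo Z

n<2^n : ∀ n → n < 2 ^ n
n<2^n zero = s≤s z≤n
n<2^n (suc n) = begin-strict
  suc n           ≡⟨ ℕP.+-comm 1 n ⟩
  n + 1           <⟨ ℕP.+-mono-<-≤ (n<2^n n) (ℕP.m^n>0 2 n) ⟩
  2 ^ n + 2 ^ n   ≡⟨ cong (λ t → 2 ^ n + t) (sym (ℕP.+-identityʳ (2 ^ n))) ⟩
  2 ^ suc n       ∎
  where open ℕP.≤-Reasoning

2^-injective : ∀ {a b} → 2 ^ a ≡ 2 ^ b → a ≡ b
2^-injective {a} {b} 2^a≡2^b with ℕP.<-cmp a b
... | tri< a<b _ _ = ⊥-elim (ℕP.<-irrefl 2^a≡2^b (ℕP.^-monoʳ-< 2 (s≤s (s≤s z≤n)) a<b))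
... | tri≈ _ a≡b _ = a≡b
... | tri> _ _ b<a = ⊥-elim (ℕP.<-irrefl (sym 2^a≡2^b) (ℕP.^-monoʳ-< 2 (s≤s (s≤s z≤n)) b<a))

2^∸1-injective : ∀ {a b} → 2 ^ a ∸ 1 ≡ 2 ^ b ∸ 1 → a ≡ b
2^∸1-injective {a} {b} eq = 2^-injective (begin
  2 ^ a             ≡⟨ sym (ℕP.m+[n∸m]≡n (ℕP.m^n>0 2 a)) ⟩
  suc (2 ^ a ∸ 1)   ≡⟨ cong suc eq ⟩
  suc (2 ^ b ∸ 1)   ≡⟨ ℕP.m+[n∸m]≡n (ℕP.m^n>0 2 b) ⟩
  2 ^ b             ∎)
  where open ≡-Reasoning

1+2*[2^e∸1]≡2^[1+e]∸1 : ∀ e → 1 + 2 * (2 ^ e ∸ 1) ≡ 2 ^ suc e ∸ 1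
1+2*[2^e∸1]≡2^[1+e]∸1 e = begin
  1 + 2 * (2 ^ e ∸ 1)          ≡⟨ cong (_∸ 1) (sym (ℕP.*-suc 2 (2 ^ e ∸ 1))) ⟩
  2 * suc (2 ^ e ∸ 1) ∸ 1      ≡⟨ cong (λ x → 2 * x ∸ 1) (ℕP.m+[n∸m]≡n (ℕP.m^n>0 2 e)) ⟩
  2 ^ suc e ∸ 1                ∎
  where open ≡-Reasoning

m+2^m*n<2^m*[1+o] : ∀ m {n o} → n ≤ o → m + 2 ^ m * n < 2 ^ m * suc o
m+2^m*n<2^m*[1+o] m {n} {o} n≤o = begin-strict
  m + 2 ^ m * n       <⟨ ℕP.+-mono-<-≤ (n<2^n m) (ℕP.*-monoʳ-≤ (2 ^ m) n≤o) ⟩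
  2 ^ m + 2 ^ m * o   ≡⟨ sym (ℕP.*-suc (2 ^ m) o) ⟩
  2 ^ m * suc o       ∎
  where open ℕP.≤-Reasoning

parity : ∀ m → ∃[ h ] (m ≡ 2 * h ⊎ m ≡ suc (2 * h))
parity zero = 0 , inj₁ refl
parity (suc m) with parity m
... | h , inj₁ m≡2h = h , inj₂ (cong suc m≡2h)
... | h , inj₂ m≡1+2h = suc h , inj₁ (trans (cong suc m≡1+2h) (sym (ℕP.*-suc 2 h)))

twoAdic : ∀ Z → .{{NonZero Z}} → ∃[ s ] ∃[ u ] Z ≡ 2 ^ s * suc (2 * u)
twoAdic Z = go Z (<-wellFounded Z) (ℕ.≢-nonZero⁻¹ Z)
  where
  go : ∀ Z → Acc _<_ Z → Z ≢ 0 → ∃[ s ] ∃[ u ] Z ≡ 2 ^ s * suc (2 * u)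
  go Z (acc rec) Z≢0 with parity Z
  ... | u , inj₂ Z≡odd = 0 , u , trans Z≡odd (sym (ℕP.*-identityˡ _))
  ... | h , inj₁ Z≡2h with go h (rec h<Z) h≢0
    where
    h≢0 : h ≢ 0
    h≢0 h≡0 = Z≢0 (trans Z≡2h (cong (2 *_) h≡0))
    h<Z : h < Z
    h<Z = subst (h <_) (sym (trans Z≡2h (ℕP.*-comm 2 h))) (ℕP.m<m*n h 2 {{ℕ.≢-nonZero h≢0}} (s≤s (s≤s z≤n)))
  ...   | s , u , h≡ = suc s , u , trans Z≡2h (trans (cong (2 *_) h≡) (sym (ℕP.*-assoc 2 (2 ^ s) _)))

odd-coprime-2 : ∀ u → Coprime (suc (2 * u)) 2
odd-coprime-2 u {i} (i∣odd , i∣2) = ∣1⇒≡1 (∣m+n∣m⇒∣n (subst (i ∣_) (ℕP.+-comm 1 (2 * u)) i∣odd) (∣-trans i∣2 (m∣m*n u)))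

odd-∣-2^*⇒∣ : ∀ u j {o} → suc (2 * u) ∣ 2 ^ j * o → suc (2 * u) ∣ o
odd-∣-2^*⇒∣ u zero {o} odd∣o = subst (suc (2 * u) ∣_) (ℕP.+-identityʳ o) odd∣o
odd-∣-2^*⇒∣ u (suc j) {o} odd∣2^j*o =
  odd-∣-2^*⇒∣ u j (coprime-divisor (odd-coprime-2 u) (subst (suc (2 * u) ∣_) (ℕP.*-assoc 2 (2 ^ j) o) odd∣2^j*o))

%≡⇒∣∸ : ∀ a b d .{{_ : NonZero d}} → a % d ≡ b % d → a ≤ b → d ∣ b ∸ a
%≡⇒∣∸ a b d a%d≡b%d a≤b = divides (b / d ∸ a / d) (begin
  b ∸ a                                      ≡⟨ cong₂ _∸_ (ℕ.m≡m%n+[m/n]*n b d) (ℕ.m≡m%n+[m/n]*n a d) ⟩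
  (b % d + b / d * d) ∸ (a % d + a / d * d)  ≡⟨ cong (λ r → (b % d + b / d * d) ∸ (r + a / d * d)) a%d≡b%d ⟩
  (b % d + b / d * d) ∸ (b % d + a / d * d)  ≡⟨ ℕP.[m+n]∸[m+o]≡n∸o (b % d) (b / d * d) (a / d * d) ⟩
  b / d * d ∸ a / d * d                      ≡⟨ sym (ℕP.*-distribʳ-∸ d (b / d) (a / d)) ⟩
  (b / d ∸ a / d) * d                        ∎)
  where open ≡-Reasoning

-- the powers 2^0, …, 2^(Z′-1) leave at most Z′ - 1 nonzero remainders modulo Z′
periodOfTwoModOdd : ∀ u → .{{NonZero u}} → ∃[ T ] 1 ≤ T × T < suc (2 * u) × suc (2 * u) ∣ 2 ^ T ∸ 1
periodOfTwoModOdd u = T , ℕP.m<n⇒0<n∸m i<j , ℕP.≤-<-trans (ℕP.m∸n≤m (toℕ j) (toℕ i)) (FinP.toℕ<n j) , Z′∣2^T∸1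
  where
  Z′ = suc (2 * u)
  r : ℕ → ℕ
  r k = 2 ^ k % Z′
  r≢0 : ∀ k → r k ≢ 0
  r≢0 k rk≡0 = ℕ.≢-nonZero⁻¹ u (ℕP.*-cancelˡ-≡ u 0 2 (ℕP.suc-injective
    (∣1⇒≡1 (odd-∣-2^*⇒∣ u k (subst (Z′ ∣_) (sym (ℕP.*-identityʳ (2 ^ k))) (m%n≡0⇒n∣m (2 ^ k) Z′ rk≡0))))))
  r∸1<2u : ∀ k → r k ∸ 1 < 2 * u
  r∸1<2u k = ℕP.∸-monoˡ-< (ℕ.m%n<n (2 ^ k) Z′) (ℕP.n≢0⇒n>0 (r≢0 k))
  collision = FinP.pigeonhole (ℕP.n<1+n (2 * u)) (λ k → fromℕ< (r∸1<2u (toℕ k)))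
  i = proj₁ collision
  j = proj₁ (proj₂ collision)
  i<j = proj₁ (proj₂ (proj₂ collision))
  T = toℕ j ∸ toℕ i
  ri≡rj : r (toℕ i) ≡ r (toℕ j)
  ri≡rj = begin
    r (toℕ i)             ≡⟨ sym (ℕP.suc-pred (r (toℕ i)) {{ℕ.≢-nonZero (r≢0 (toℕ i))}}) ⟩
    suc (r (toℕ i) ∸ 1)   ≡⟨ cong suc (trans (sym (FinP.toℕ-fromℕ< (r∸1<2u (toℕ i))))
                             (trans (cong toℕ (proj₂ (proj₂ (proj₂ collision)))) (FinP.toℕ-fromℕ< (r∸1<2u (toℕ j))))) ⟩
    suc (r (toℕ j) ∸ 1)   ≡⟨ ℕP.suc-pred (r (toℕ j)) {{ℕ.≢-nonZero (r≢0 (toℕ j))}} ⟩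
    r (toℕ j)             ∎
    where open ≡-Reasoning
  2^j∸2^i≡ : 2 ^ toℕ j ∸ 2 ^ toℕ i ≡ 2 ^ toℕ i * (2 ^ T ∸ 1)
  2^j∸2^i≡ = begin
    2 ^ toℕ j ∸ 2 ^ toℕ i                ≡⟨ cong (_∸ 2 ^ toℕ i) (cong (2 ^_) (sym (ℕP.m+[n∸m]≡n (ℕP.<⇒≤ i<j)))) ⟩
    2 ^ (toℕ i + T) ∸ 2 ^ toℕ i          ≡⟨ cong₂ _∸_ (ℕP.^-distribˡ-+-* 2 (toℕ i) T) (sym (ℕP.*-identityʳ (2 ^ toℕ i))) ⟩
    2 ^ toℕ i * 2 ^ T ∸ 2 ^ toℕ i * 1    ≡⟨ sym (ℕP.*-distribˡ-∸ (2 ^ toℕ i) (2 ^ T) 1) ⟩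
    2 ^ toℕ i * (2 ^ T ∸ 1)              ∎
    where open ≡-Reasoning
  Z′∣2^T∸1 : Z′ ∣ 2 ^ T ∸ 1
  Z′∣2^T∸1 = odd-∣-2^*⇒∣ u (toℕ i) (subst (Z′ ∣_) 2^j∸2^i≡
    (%≡⇒∣∸ (2 ^ toℕ i) (2 ^ toℕ j) Z′ ri≡rj (ℕP.^-monoʳ-≤ 2 (ℕP.<⇒≤ i<j))))

periodOfTwo : ∀ Z → .{{NonZero Z}} →
  ∃[ s ] ∃[ T ] 1 ≤ T × Z ∣ 2 ^ s * (2 ^ T ∸ 1) × (Z ≡ 2 ^ s ⊎ s + 2 ^ s * T < Z)
periodOfTwo Z = period (twoAdic Z)
  where
  period : ∃[ s ] ∃[ u ] Z ≡ 2 ^ s * suc (2 * u) →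
    ∃[ s ] ∃[ T ] 1 ≤ T × Z ∣ 2 ^ s * (2 ^ T ∸ 1) × (Z ≡ 2 ^ s ⊎ s + 2 ^ s * T < Z)
  period (s , zero , Z≡) = s , 1 , ℕP.≤-refl , subst (_∣ 2 ^ s * 1) (sym Z≡) ∣-refl , inj₁ (trans Z≡ (ℕP.*-identityʳ (2 ^ s)))
  period (s , suc u , Z≡) =
    let T , 1≤T , T<Z′ , Z′∣2^T∸1 = periodOfTwoModOdd (suc u) in
    s , T , 1≤T , subst (_∣ 2 ^ s * (2 ^ T ∸ 1)) (sym Z≡) (*-monoʳ-∣ (2 ^ s) Z′∣2^T∸1) ,
    inj₂ (subst (s + 2 ^ s * T <_) (sym Z≡) (m+2^m*n<2^m*[1+o] s (ℕP.≤-pred T<Z′)))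

total≡∑ : ∀ {n} (f : Fin n → ℕ) → total f ≡ ∑[ i < n ] f i
total≡∑ {zero} f = refl
total≡∑ {suc n} f = cong (f Fin.zero +_) (total≡∑ (f ∘ Fin.suc))

∑-mono-≤ : ∀ {n} {f g : Fin n → ℕ} → (∀ i → f i ≤ g i) → ∑[ i < n ] f i ≤ ∑[ i < n ] g i
∑-mono-≤ {zero} f≤g = z≤n
∑-mono-≤ {suc n} f≤g = ℕP.+-mono-≤ (f≤g Fin.zero) (∑-mono-≤ (f≤g ∘ Fin.suc))

∑-const : ∀ n c → ∑[ i < n ] c ≡ n * c
∑-const zero c = refl
∑-const (suc n) c = cong (c +_) (∑-const n c)

isHalt-suc : ∀ {n} (i j : Fin n) → isHalt (Fin.suc i) (halted (Fin.suc j)) ≡ isHalt i (halted j)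
isHalt-suc i j with i Fin.≟ j
... | yes _ = refl
... | no _ = refl

∑-isHalt : ∀ {n} (j : Fin n) → ∑[ i < n ] isHalt i (halted j) ≡ 1
∑-isHalt {suc n} Fin.zero = cong suc (sum-replicate-zero n)
∑-isHalt {suc n} (Fin.suc j) = trans (sum-cong-≗ (λ i → isHalt-suc i j)) (∑-isHalt j)

sumBelow : ℕ → (ℕ → ℕ) → ℕ
sumBelow zero f = 0
sumBelow (suc N) f = sumBelow N f + f N

sumBelow-cong : ∀ N {f g} → (∀ {t} → t < N → f t ≡ g t) → sumBelow N f ≡ sumBelow N g
sumBelow-cong zero f≡g = refl
sumBelow-cong (suc N) f≡g = cong₂ _+_ (sumBelow-cong N (f≡g ∘ ℕP.m<n⇒m<1+n)) (f≡g ℕP.≤-refl)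

sumBelow-const : ∀ N c → sumBelow N (λ _ → c) ≡ N * c
sumBelow-const zero c = refl
sumBelow-const (suc N) c = trans (cong (_+ c) (sumBelow-const N c)) (ℕP.+-comm (N * c) c)

sumBelow-*ˡ : ∀ N c f → sumBelow N (λ t → c * f t) ≡ c * sumBelow N f
sumBelow-*ˡ zero c f = sym (ℕP.*-zeroʳ c)
sumBelow-*ˡ (suc N) c f = trans (cong (_+ c * f N) (sumBelow-*ˡ N c f)) (sym (ℕP.*-distribˡ-+ c (sumBelow N f) (f N)))

sumBelow-+ : ∀ a b f → sumBelow (a + b) f ≡ sumBelow a f + sumBelow b (f ∘ (a +_))
sumBelow-+ a zero f = trans (cong (λ N → sumBelow N f) (ℕP.+-identityʳ a)) (sym (ℕP.+-identityʳ _))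
sumBelow-+ a (suc b) f = begin
  sumBelow (a + suc b) f                                    ≡⟨ cong (λ N → sumBelow N f) (ℕP.+-suc a b) ⟩
  sumBelow (a + b) f + f (a + b)                            ≡⟨ cong (_+ f (a + b)) (sumBelow-+ a b f) ⟩
  sumBelow a f + sumBelow b (f ∘ (a +_)) + f (a + b)        ≡⟨ ℕP.+-assoc (sumBelow a f) _ _ ⟩
  sumBelow a f + (sumBelow b (f ∘ (a +_)) + f (a + b))      ∎
  where open ≡-Reasoning

sumBelow-pairs : ∀ N f → sumBelow N (λ j → f (2 * j) + f (suc (2 * j))) ≡ sumBelow (2 * N) f
sumBelow-pairs zero f = refl
sumBelow-pairs (suc N) f = begin
  sumBelow N (λ j → f (2 * j) + f (suc (2 * j))) + (f (2 * N) + f (suc (2 * N)))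
    ≡⟨ cong (_+ (f (2 * N) + f (suc (2 * N)))) (sumBelow-pairs N f) ⟩
  sumBelow (2 * N) f + (f (2 * N) + f (suc (2 * N)))  ≡⟨ sym (ℕP.+-assoc (sumBelow (2 * N) f) _ _) ⟩
  sumBelow (suc (suc (2 * N))) f                      ≡⟨ cong (λ M → sumBelow M f) (sym (ℕP.*-suc 2 N)) ⟩
  sumBelow (2 * suc N) f                              ∎
  where open ≡-Reasoning

-- cut ℕ into consecutive blocks of lengths β 0, β 1, …; block β t is the block containing t
block : ∀ {n} → (Fin (suc n) → ℕ) → ℕ → Fin (suc n)
block {zero} β t = Fin.zero
block {suc n} β t with t ℕP.<? β Fin.zero
... | yes _ = Fin.zero
... | no _ = Fin.suc (block (β ∘ Fin.suc) (t ∸ β Fin.zero))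

block-head : ∀ {n} (β : Fin (suc (suc n)) → ℕ) {t} → t < β Fin.zero → block β t ≡ Fin.zero
block-head β {t} t<β₀ with t ℕP.<? β Fin.zero
... | yes _ = refl
... | no t≮β₀ = ⊥-elim (t≮β₀ t<β₀)

block-tail : ∀ {n} (β : Fin (suc (suc n)) → ℕ) t → block β (β Fin.zero + t) ≡ Fin.suc (block (β ∘ Fin.suc) t)
block-tail β t with β Fin.zero + t ℕP.<? β Fin.zero
... | yes β₀+t<β₀ = ⊥-elim (ℕP.m+n≮m (β Fin.zero) t β₀+t<β₀)
... | no _ = cong (Fin.suc ∘ block (β ∘ Fin.suc)) (ℕP.m+n∸m≡n (β Fin.zero) t)

block-size : ∀ {n} (β : Fin (suc n) → ℕ) i → sumBelow (∑[ j < suc n ] β j) (λ t → isHalt i (halted (block β t))) ≡ β i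
block-size {zero} β Fin.zero = trans (sumBelow-const (β Fin.zero + 0) 1) (trans (ℕP.*-identityʳ _) (ℕP.+-identityʳ _))
block-size {suc n} β i = begin
  sumBelow (β₀ + ∑β′) inBlock                                     ≡⟨ sumBelow-+ β₀ ∑β′ inBlock ⟩
  sumBelow β₀ inBlock + sumBelow ∑β′ (inBlock ∘ (β₀ +_))
    ≡⟨ cong₂ _+_ (sumBelow-cong β₀ (cong (λ j → isHalt i (halted j)) ∘ block-head β))
                 (sumBelow-cong ∑β′ λ {t} _ → cong (λ j → isHalt i (halted j)) (block-tail β t)) ⟩
  sumBelow β₀ (λ _ → isHalt i (halted Fin.zero)) + sumBelow ∑β′ (λ t → isHalt i (halted (Fin.suc (block β′ t))))
    ≡⟨ split i ⟩
  β i                                                             ∎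
  where
  open ≡-Reasoning
  β₀ = β Fin.zero
  β′ = β ∘ Fin.suc
  ∑β′ = ∑[ j < suc n ] β′ j
  inBlock = λ t → isHalt i (halted (block β t))
  split : ∀ i → sumBelow β₀ (λ _ → isHalt i (halted Fin.zero)) + sumBelow ∑β′ (λ t → isHalt i (halted (Fin.suc (block β′ t)))) ≡ β i
  split Fin.zero = trans (cong₂ _+_ (trans (sumBelow-const β₀ 1) (ℕP.*-identityʳ β₀)) (trans (sumBelow-const ∑β′ 0) (ℕP.*-zeroʳ ∑β′)))
                         (ℕP.+-identityʳ β₀)
  split (Fin.suc i) = trans (cong₂ _+_ (trans (sumBelow-const β₀ 0) (ℕP.*-zeroʳ β₀))
                                      (sumBelow-cong ∑β′ λ {t} _ → isHalt-suc i (block β′ t)))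
                            (block-size β′ i)

-- Counting bit strings

sumL-++ : ∀ xs ys → sumL (xs ++ ys) ≡ sumL xs + sumL ys
sumL-++ [] ys = refl
sumL-++ (x ∷ xs) ys = trans (cong (x +_) (sumL-++ xs ys)) (sym (ℕP.+-assoc x _ _))

count : (List Bool → ℕ) → ℕ → ℕ
count f k = sumL (map f (allBits k))

count-cong : ∀ {f g} k → (∀ w → f w ≡ g w) → count f k ≡ count g k
count-cong k f≗g = cong sumL (List.map-cong f≗g (allBits k))

count-suc : ∀ f k → count f (suc k) ≡ count (f ∘ (true ∷_)) k + count (f ∘ (false ∷_)) k
count-suc f k = begin
  sumL (map f (ones ++ zeros))             ≡⟨ cong sumL (List.map-++ f ones zeros) ⟩
  sumL (map f ones ++ map f zeros)         ≡⟨ sumL-++ (map f ones) (map f zeros) ⟩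
  sumL (map f ones) + sumL (map f zeros)
    ≡⟨ cong₂ _+_ (cong sumL (sym (List.map-∘ (allBits k)))) (cong sumL (sym (List.map-∘ (allBits k)))) ⟩
  count (f ∘ (true ∷_)) k + count (f ∘ (false ∷_)) k ∎
  where
  open ≡-Reasoning
  ones = map (true ∷_) (allBits k)
  zeros = map (false ∷_) (allBits k)

count-const : ∀ {f} c k → (∀ w → f w ≡ c) → count f k ≡ 2 ^ k * c
count-const c zero f≡c = trans (ℕP.+-identityʳ _) (trans (f≡c []) (sym (ℕP.*-identityˡ c)))
count-const {f} c (suc k) f≡c = begin
  count f (suc k)                                    ≡⟨ count-suc f k ⟩
  count (f ∘ (true ∷_)) k + count (f ∘ (false ∷_)) k
    ≡⟨ cong₂ _+_ (count-const c k (f≡c ∘ (true ∷_))) (count-const c k (f≡c ∘ (false ∷_))) ⟩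
  2 ^ k * c + 2 ^ k * c                              ≡⟨ sym (ℕP.*-distribʳ-+ c (2 ^ k) (2 ^ k)) ⟩
  (2 ^ k + 2 ^ k) * c                                ≡⟨ cong (λ t → (2 ^ k + t) * c) (sym (ℕP.+-identityʳ (2 ^ k))) ⟩
  2 ^ suc k * c                                      ∎
  where open ≡-Reasoning

module _ {N : Set} {n : ℕ} (T : DDG N n) where

  leaf-or-branch : ∀ x → (∃ λ j → c T x ≡ leaf j) ⊎ c T x ≡ branch
  leaf-or-branch x with c T x
  ... | leaf j = inj₁ (j , refl)
  ... | branch = inj₂ refl

  walk-branch : ∀ {x} b w → c T x ≡ branch → walk T x (b ∷ w) ≡ walk T (δ T x b) w
  walk-branch {x} b w cx≡branch with c T x
  walk-branch b w refl | .branch = refl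

  walk-[] : ∀ {x} → c T x ≡ branch → walk T x [] ≡ running
  walk-[] {x} cx≡branch with c T x
  walk-[] refl | .branch = refl

  walk-leaf : ∀ {x j} w → c T x ≡ leaf j → walk T x w ≡ halted j
  walk-leaf {x} w cx≡leaf with c T x
  walk-leaf w refl | .(leaf _) = refl

  countFrom : N → (Result n → ℕ) → ℕ → ℕ
  countFrom x obs k = count (obs ∘ walk T x) k

  countFrom-branch : ∀ {x} obs k → c T x ≡ branch →
    countFrom x obs (suc k) ≡ countFrom (δ T x true) obs k + countFrom (δ T x false) obs k
  countFrom-branch {x} obs k cx≡branch = trans (count-suc (obs ∘ walk T x) k)
    (cong₂ _+_ (count-cong k (λ w → cong obs (walk-branch true w cx≡branch)))
               (count-cong k (λ w → cong obs (walk-branch false w cx≡branch))))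

  countFrom-branch-0 : ∀ {x} obs → c T x ≡ branch → countFrom x obs 0 ≡ obs running
  countFrom-branch-0 obs cx≡branch = trans (ℕP.+-identityʳ _) (cong obs (walk-[] cx≡branch))

  countFrom-leaf : ∀ {x j} obs k → c T x ≡ leaf j → countFrom x obs k ≡ 2 ^ k * obs (halted j)
  countFrom-leaf obs k cx≡leaf = count-const _ k (λ w → cong obs (walk-leaf w cx≡leaf))

  conservation : ∀ x k → countFrom x isRunning k + ∑[ i < n ] countFrom x (isHalt i) k ≡ 2 ^ k
  conservation x k with leaf-or-branch x
  ... | inj₁ (j , cx) = begin
    countFrom x isRunning k + ∑[ i < n ] countFrom x (isHalt i) k
      ≡⟨ cong₂ _+_ (countFrom-leaf isRunning k cx) (sum-cong-≗ (λ i → countFrom-leaf (isHalt i) k cx)) ⟩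
    2 ^ k * 0 + ∑[ i < n ] (2 ^ k * isHalt i (halted j))
      ≡⟨ cong₂ _+_ (ℕP.*-zeroʳ (2 ^ k)) (sym (*-distribˡ-sum (2 ^ k) (λ i → isHalt i (halted j)))) ⟩
    2 ^ k * ∑[ i < n ] isHalt i (halted j)   ≡⟨ cong (2 ^ k *_) (∑-isHalt j) ⟩
    2 ^ k * 1                                ≡⟨ ℕP.*-identityʳ (2 ^ k) ⟩
    2 ^ k                                    ∎
    where open ≡-Reasoning
  ... | inj₂ cx with k
  ...   | zero = cong₂ _+_ (countFrom-branch-0 isRunning cx)
                           (trans (sum-cong-≗ (λ i → countFrom-branch-0 (isHalt i) cx)) (sum-replicate-zero n))
  ...   | suc k = begin
    countFrom x isRunning (suc k) + ∑[ i < n ] countFrom x (isHalt i) (suc k)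
      ≡⟨ cong₂ _+_ (countFrom-branch isRunning k cx)
                   (trans (sum-cong-≗ (λ i → countFrom-branch (isHalt i) k cx))
                          (∑-distrib-+ (λ i → countFrom (δ T x true) (isHalt i) k) (λ i → countFrom (δ T x false) (isHalt i) k))) ⟩
    (run₁ + run₀) + (halt₁ + halt₀)     ≡⟨ interchange run₁ run₀ halt₁ halt₀ ⟩
    (run₁ + halt₁) + (run₀ + halt₀)     ≡⟨ cong₂ _+_ (conservation (δ T x true) k) (conservation (δ T x false) k) ⟩
    2 ^ k + 2 ^ k                       ≡⟨ cong (2 ^ k +_) (sym (ℕP.+-identityʳ (2 ^ k))) ⟩
    2 ^ suc k                           ∎
    where
    open ≡-Reasoning
    run₁ = countFrom (δ T x true) isRunning k
    run₀ = countFrom (δ T x false) isRunning k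
    halt₁ = ∑[ i < n ] countFrom (δ T x true) (isHalt i) k
    halt₀ = ∑[ i < n ] countFrom (δ T x false) (isHalt i) k

  -- halted strings stay halted when extended by one bit
  countFrom-doubling : ∀ obs → obs running ≡ 0 → ∀ x k → 2 * countFrom x obs k ≤ countFrom x obs (suc k)
  countFrom-doubling obs obs-running x k with leaf-or-branch x
  ... | inj₁ (j , cx) = ℕP.≤-reflexive (begin
    2 * countFrom x obs k           ≡⟨ cong (2 *_) (countFrom-leaf obs k cx) ⟩
    2 * (2 ^ k * obs (halted j))    ≡⟨ sym (ℕP.*-assoc 2 (2 ^ k) _) ⟩
    2 ^ suc k * obs (halted j)      ≡⟨ sym (countFrom-leaf obs (suc k) cx) ⟩
    countFrom x obs (suc k)         ∎)
    where open ≡-Reasoning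
  ... | inj₂ cx with k
  ...   | zero = ℕP.≤-trans (ℕP.≤-reflexive (cong (2 *_) (trans (countFrom-branch-0 obs cx) obs-running))) z≤n
  ...   | suc k = begin
    2 * countFrom x obs (suc k)                            ≡⟨ cong (2 *_) (countFrom-branch obs k cx) ⟩
    2 * (countFrom x₁ obs k + countFrom x₀ obs k)         ≡⟨ ℕP.*-distribˡ-+ 2 (countFrom x₁ obs k) _ ⟩
    2 * countFrom x₁ obs k + 2 * countFrom x₀ obs k
      ≤⟨ ℕP.+-mono-≤ (countFrom-doubling obs obs-running x₁ k) (countFrom-doubling obs obs-running x₀ k) ⟩
    countFrom x₁ obs (suc k) + countFrom x₀ obs (suc k)   ≡⟨ sym (countFrom-branch obs (suc k) cx) ⟩
    countFrom x obs (suc (suc k))                         ∎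
    where
    open ℕP.≤-Reasoning
    x₁ = δ T x true
    x₀ = δ T x false

  haltCount-doubling : ∀ i k K → 2 ^ K * haltCount T i k ≤ haltCount T i (K + k)
  haltCount-doubling i k zero = ℕP.≤-reflexive (ℕP.+-identityʳ _)
  haltCount-doubling i k (suc K) = begin
    2 * 2 ^ K * haltCount T i k      ≡⟨ ℕP.*-assoc 2 (2 ^ K) _ ⟩
    2 * (2 ^ K * haltCount T i k)    ≤⟨ ℕP.*-monoʳ-≤ 2 (haltCount-doubling i k K) ⟩
    2 * haltCount T i (K + k)        ≤⟨ countFrom-doubling (isHalt i) refl (root T) (K + k) ⟩
    haltCount T i (suc K + k)        ∎
    where open ℕP.≤-Reasoning

  runCount≡ : ∀ k → runCount T k ≡ 2 ^ k ∸ ∑[ i < n ] haltCount T i k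
  runCount≡ k = sym (trans (cong (_∸ ∑[ i < n ] haltCount T i k) (sym (conservation (root T) k)))
                           (ℕP.m+n∸n≡m (runCount T k) (∑[ i < n ] haltCount T i k)))

toℚᵘ-/ : ∀ x d → toℚᵘ (x ℚ./ suc d) ℚᵘ.≃ mkℚᵘ x d
toℚᵘ-/ x d = ℚP.toℚᵘ-fromℚᵘ (mkℚᵘ x d)

/<⇒*< : ∀ x y X Y .{{_ : NonZero X}} .{{_ : NonZero Y}} → ℤ.+ x ℚ./ X ℚ.< ℤ.+ y ℚ./ Y → x * Y < y * X
/<⇒*< x y (suc X) (suc Y) x/X<y/Y
  with ℚᵘP.<-respˡ-≃ (toℚᵘ-/ (ℤ.+ x) X) (ℚᵘP.<-respʳ-≃ (toℚᵘ-/ (ℤ.+ y) Y) (ℚP.toℚᵘ-mono-< x/X<y/Y))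
... | *<* xY<yX = ℤP.drop‿+<+ (subst₂ ℤ._<_ (sym (ℤP.pos-* x (suc Y))) (sym (ℤP.pos-* y (suc X))) xY<yX)

*<⇒/< : ∀ x y X Y .{{_ : NonZero X}} .{{_ : NonZero Y}} → x * Y < y * X → ℤ.+ x ℚ./ X ℚ.< ℤ.+ y ℚ./ Y
*<⇒/< x y (suc X) (suc Y) xY<yX = ℚP.toℚᵘ-cancel-<
  (ℚᵘP.<-respˡ-≃ (ℚᵘP.≃-sym (toℚᵘ-/ (ℤ.+ x) X)) (ℚᵘP.<-respʳ-≃ (ℚᵘP.≃-sym (toℚᵘ-/ (ℤ.+ y) Y))
    (*<* (subst₂ ℤ._<_ (ℤP.pos-* x (suc Y)) (ℤP.pos-* y (suc X)) (ℤ.+<+ xY<yX)))))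

*≤⇒/≤ : ∀ x y X Y .{{_ : NonZero X}} .{{_ : NonZero Y}} → x * Y ≤ y * X → ℤ.+ x ℚ./ X ℚ.≤ ℤ.+ y ℚ./ Y
*≤⇒/≤ x y (suc X) (suc Y) xY≤yX = ℚP.toℚᵘ-cancel-≤
  (ℚᵘP.≤-respˡ-≃ (ℚᵘP.≃-sym (toℚᵘ-/ (ℤ.+ x) X)) (ℚᵘP.≤-respʳ-≃ (ℚᵘP.≃-sym (toℚᵘ-/ (ℤ.+ y) Y))
    (*≤* (subst₂ ℤ._≤_ (ℤP.pos-* x (suc Y)) (ℤP.pos-* y (suc X)) (ℤ.+≤+ xY≤yX)))))

∣/-/∣ : ∀ a b A B .{{_ : NonZero A}} .{{_ : NonZero B}} →
  ℚ.∣ ℤ.+ a ℚ./ A ℚ.- ℤ.+ b ℚ./ B ∣ ≡ ℚ._/_ (ℤ.+ ℤ.∣ a * B ⊖ b * A ∣) (A * B) {{ℕP.m*n≢0 A B}}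
∣/-/∣ a b (suc A) (suc B) = ℚP.toℚᵘ-injective (ℚᵘP.≃-trans lhs≃ (ℚᵘP.≃-sym (toℚᵘ-/ _ (ℕ.pred (suc A * suc B)))))
  where
  open ℚᵘP
  numerator : (ℤ.+ a) ℤ.* (ℤ.+ suc B) ℤ.+ ℤ.- (ℤ.+ b) ℤ.* (ℤ.+ suc A) ≡ a * suc B ⊖ b * suc A
  numerator = begin
    (ℤ.+ a) ℤ.* (ℤ.+ suc B) ℤ.+ ℤ.- (ℤ.+ b) ℤ.* (ℤ.+ suc A)
      ≡⟨ cong₂ ℤ._+_ (sym (ℤP.pos-* a (suc B))) (sym (ℤP.neg-distribˡ-* (ℤ.+ b) (ℤ.+ suc A))) ⟩
    ℤ.+ (a * suc B) ℤ.+ ℤ.- ((ℤ.+ b) ℤ.* (ℤ.+ suc A))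
      ≡⟨ cong (λ t → ℤ.+ (a * suc B) ℤ.+ ℤ.- t) (sym (ℤP.pos-* b (suc A))) ⟩
    ℤ.+ (a * suc B) ℤ.+ ℤ.- (ℤ.+ (b * suc A))   ≡⟨ ℤP.m-n≡m⊖n (a * suc B) (b * suc A) ⟩
    a * suc B ⊖ b * suc A                    ∎
    where open ≡-Reasoning
  lhs≃ : toℚᵘ ℚ.∣ ℤ.+ a ℚ./ suc A ℚ.- ℤ.+ b ℚ./ suc B ∣ ℚᵘ.≃ mkℚᵘ (ℤ.+ ℤ.∣ a * suc B ⊖ b * suc A ∣) (ℕ.pred (suc A * suc B))
  lhs≃ = ≃-trans (ℚP.toℚᵘ-homo-∣-∣ (ℤ.+ a ℚ./ suc A ℚ.- ℤ.+ b ℚ./ suc B))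
         (≃-trans (∣-∣-cong (≃-trans (ℚP.toℚᵘ-homo-+ (ℤ.+ a ℚ./ suc A) (ℚ.- (ℤ.+ b ℚ./ suc B)))
                               (+-cong (toℚᵘ-/ (ℤ.+ a) A) (≃-trans (ℚP.toℚᵘ-homo‿- (ℤ.+ b ℚ./ suc B)) (-‿cong (toℚᵘ-/ (ℤ.+ b) B))))))
                  (≃-reflexive (cong (λ t → mkℚᵘ (ℤ.+ ℤ.∣ t ∣) (ℕ.pred (suc A * suc B))) numerator)))

positive⇒/ : ∀ ε → 0ℚ ℚ.< ε → ∃[ u ] ∃[ V ] ε ≡ ℤ.+ suc u ℚ./ suc V
positive⇒/ ε 0<ε = go ε (ℚ.positive 0<ε)
  where
  go : ∀ ε → ℚ.Positive ε → ∃[ u ] ∃[ V ] ε ≡ ℤ.+ suc u ℚ./ suc V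
  go (mkℚ (ℤ.+ suc u) V coprime) _ = u , V , sym (ℚP.↥p/↧p≡p (mkℚ (ℤ.+ suc u) V coprime))

-- Floor samplers are exact and entropy optimal

module _ {n : ℕ} (M : Fin n → ℕ) .{{_ : NonZero (total M)}} where

  private
    Z = total M

  FloorCounts : ∀ {N} → DDG N n → Set
  FloorCounts T = ∀ i k → haltCount T i k ≡ (2 ^ k * M i) / Z

  haltError : ∀ h i k → let instance _ = ℕP.m*n≢0 (2 ^ k) Z {{ℕP.m^n≢0 2 k}} in
    ℚ.∣ over2^ h k ℚ.- target M i ∣ ≡ ℤ.+ ℤ.∣ h * Z ⊖ M i * 2 ^ k ∣ ℚ./ (2 ^ k * Z)
  haltError h i k = ∣/-/∣ h (M i) (2 ^ k) Z {{ℕP.m^n≢0 2 k}}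

  floor⇒exact : ∀ {N} (T : DDG N n) → FloorCounts T → ExactFor T (target M)
  floor⇒exact T floor i ε 0<ε with positive⇒/ ε 0<ε
  ... | u , V , refl = suc V , close
    where
    close : ∀ k → suc V ≤ k → ℚ.∣ haltProb T i k ℚ.- target M i ∣ ℚ.< ℤ.+ suc u ℚ./ suc V
    close k V<k = subst (ℚ._< ℤ.+ suc u ℚ./ suc V) (sym error) (*<⇒/< (X % Z) (suc u) (2 ^ k * Z) (suc V) (begin-strict
      X % Z * suc V         <⟨ ℕP.*-monoˡ-< (suc V) (ℕ.m%n<n X Z) ⟩
      Z * suc V             ≤⟨ ℕP.*-monoʳ-≤ Z (ℕP.≤-trans V<k (ℕP.<⇒≤ (n<2^n k))) ⟩
      Z * 2 ^ k             ≡⟨ ℕP.*-comm Z (2 ^ k) ⟩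
      2 ^ k * Z             ≤⟨ ℕP.m≤n*m (2 ^ k * Z) (suc u) ⟩
      suc u * (2 ^ k * Z)   ∎))
      where
      open ℕP.≤-Reasoning
      instance _ = ℕP.m*n≢0 (2 ^ k) Z {{ℕP.m^n≢0 2 k}}
      X = 2 ^ k * M i
      numerator : ℤ.∣ X / Z * Z ⊖ M i * 2 ^ k ∣ ≡ X % Z
      numerator = begin-equality
        ℤ.∣ X / Z * Z ⊖ M i * 2 ^ k ∣ ≡⟨ cong (λ t → ℤ.∣ X / Z * Z ⊖ t ∣) (ℕP.*-comm (M i) (2 ^ k)) ⟩
        ℤ.∣ X / Z * Z ⊖ X ∣          ≡⟨ ℤP.∣⊖∣-≤ (ℕ.m/n*n≤m X Z) ⟩
        X ∸ X / Z * Z                 ≡⟨ sym (ℕ.m%n≡m∸m/n*n X Z) ⟩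
        X % Z                         ∎
      error : ℚ.∣ haltProb T i k ℚ.- target M i ∣ ≡ ℤ.+ (X % Z) ℚ./ (2 ^ k * Z)
      error = trans (cong (λ h → ℚ.∣ over2^ h k ℚ.- target M i ∣) (floor i k))
                    (trans (haltError (X / Z) i k) (cong (λ t → ℤ.+ t ℚ./ (2 ^ k * Z)) numerator))

  -- the halting frequencies can only grow, so none of them overshoots its limit
  exact⇒haltCount*Z≤ : ∀ {N} (T : DDG N n) → ExactFor T (target M) → ∀ i k → haltCount T i k * Z ≤ 2 ^ k * M i
  exact⇒haltCount*Z≤ T exact i k with haltCount T i k * Z ℕP.≤? 2 ^ k * M i
  ... | yes hZ≤X = hZ≤X
  ... | no hZ≰X = ⊥-elim (ℕP.<-irrefl refl (ℕP.<-≤-trans too-close far))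
    where
    instance _ = ℕP.m*n≢0 (2 ^ k) Z {{ℕP.m^n≢0 2 k}}
    h = haltCount T i k
    X = 2 ^ k * M i
    ε = ℤ.+ 1 ℚ./ (2 ^ k * Z)
    convergence = exact i ε (*<⇒/< 0 1 1 (2 ^ k * Z) (ℕP.≤-reflexive (sym (ℕP.*-identityʳ 1))))
    K = proj₁ convergence
    j = K + k
    instance _ = ℕP.m*n≢0 (2 ^ j) Z {{ℕP.m^n≢0 2 j}}
    hⱼ = haltCount T i j
    gap : M i * 2 ^ j + 2 ^ K ≤ hⱼ * Z
    gap = begin
      M i * 2 ^ j + 2 ^ K       ≡⟨ cong (λ t → M i * t + 2 ^ K) (ℕP.^-distribˡ-+-* 2 K k) ⟩
      M i * (2 ^ K * 2 ^ k) + 2 ^ K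
        ≡⟨ cong (_+ 2 ^ K) (trans (ℕP.*-comm (M i) (2 ^ K * 2 ^ k)) (ℕP.*-assoc (2 ^ K) (2 ^ k) (M i))) ⟩
      2 ^ K * X + 2 ^ K         ≡⟨ trans (ℕP.+-comm (2 ^ K * X) (2 ^ K)) (sym (ℕP.*-suc (2 ^ K) X)) ⟩
      2 ^ K * suc X             ≤⟨ ℕP.*-monoʳ-≤ (2 ^ K) (ℕP.≰⇒> hZ≰X) ⟩
      2 ^ K * (h * Z)           ≡⟨ sym (ℕP.*-assoc (2 ^ K) h Z) ⟩
      2 ^ K * h * Z             ≤⟨ ℕP.*-monoˡ-≤ Z (haltCount-doubling T i k K) ⟩
      hⱼ * Z                    ∎
      where open ℕP.≤-Reasoning
    e = hⱼ * Z ∸ M i * 2 ^ j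
    error : ℚ.∣ haltProb T i j ℚ.- target M i ∣ ≡ ℤ.+ e ℚ./ (2 ^ j * Z)
    error = trans (haltError hⱼ i j) (cong (λ t → ℤ.+ t ℚ./ (2 ^ j * Z))
              (trans (ℤP.∣m⊖n∣≡∣n⊖m∣ (hⱼ * Z) (M i * 2 ^ j)) (ℤP.∣⊖∣-≤ (ℕP.≤-trans (ℕP.m≤m+n (M i * 2 ^ j) (2 ^ K)) gap))))
    too-close : e * (2 ^ k * Z) < 1 * (2 ^ j * Z)
    too-close = /<⇒*< e 1 (2 ^ j * Z) (2 ^ k * Z) (subst (ℚ._< ε) error (proj₂ convergence j (ℕP.m≤m+n K k)))
    far : 1 * (2 ^ j * Z) ≤ e * (2 ^ k * Z)
    far = begin
      1 * (2 ^ j * Z)           ≡⟨ ℕP.*-identityˡ _ ⟩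
      2 ^ j * Z                 ≡⟨ trans (cong (_* Z) (ℕP.^-distribˡ-+-* 2 K k)) (ℕP.*-assoc (2 ^ K) (2 ^ k) Z) ⟩
      2 ^ K * (2 ^ k * Z)       ≤⟨ ℕP.*-monoˡ-≤ (2 ^ k * Z) (subst (_≤ e) (ℕP.m+n∸m≡n (M i * 2 ^ j) (2 ^ K)) (ℕP.∸-monoˡ-≤ (M i * 2 ^ j) gap)) ⟩
      e * (2 ^ k * Z)           ∎
      where open ℕP.≤-Reasoning

  floor⇒runCount≤ : ∀ {N N′} (T : DDG N n) → FloorCounts T → (T′ : DDG N′ n) → ExactFor T′ (target M) →
    ∀ k → runCount T k ≤ runCount T′ k
  floor⇒runCount≤ T floor T′ exact k = subst₂ _≤_ (sym (runCount≡ T k)) (sym (runCount≡ T′ k))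
    (ℕP.∸-monoʳ-≤ (2 ^ k) (∑-mono-≤ λ i → subst (haltCount T′ i k ≤_) (sym (floor i k))
      (subst (_≤ (2 ^ k * M i) / Z) (ℕ.m*n/n≡m (haltCount T′ i k) Z) (ℕ./-monoˡ-≤ Z (exact⇒haltCount*Z≤ T′ exact i k)))))

runCount≤⇒expBitsLeq : ∀ {N N′ n} (T : DDG N n) (T′ : DDG N′ n) → (∀ k → runCount T k ≤ runCount T′ k) → ExpBitsLeq T T′
runCount≤⇒expBitsLeq T T′ runs≤ K ε 0<ε = K , ℚP.≤-trans (partial≤ K)
  (subst (ℚ._≤ expBitsPartial T′ K ℚ.+ ε) (ℚP.+-identityʳ (expBitsPartial T′ K)) (ℚP.+-monoʳ-≤ (expBitsPartial T′ K) (ℚP.<⇒≤ 0<ε)))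
  where
  partial≤ : ∀ K → expBitsPartial T K ℚ.≤ expBitsPartial T′ K
  partial≤ zero = ℚP.≤-refl
  partial≤ (suc K) = ℚP.+-mono-≤ (partial≤ K) (*≤⇒/≤ (runCount T K) (runCount T′ K) (2 ^ K) (2 ^ K)
    {{ℕP.m^n≢0 2 K}} {{ℕP.m^n≢0 2 K}} (ℕP.*-monoˡ-≤ (2 ^ K) (runs≤ K)))

floor⇒optimal : ∀ {N n} (M : Fin n → ℕ) .{{_ : NonZero (total M)}} (T : DDG N n) → FloorCounts M T →
  EntropyOptimal T (target M)
floor⇒optimal M T floor T′ exact = runCount≤⇒expBitsLeq T T′ (floor⇒runCount≤ M T floor T′ exact)

-- Simple leaf paths and precision

module _ {N : Set} {n : ℕ} (T : DDG N n) where

  trail : (ℕ → Bool) → ℕ → N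
  trail bits zero = root T
  trail bits (suc t) = δ T (trail bits t) (bits t)

  record SimpleLeafTrail (k : ℕ) (bits : ℕ → Bool) : Set where
    field
      branches : ∀ {t} → t < k → IsBranch (c T (trail bits t))
      endsLeaf : ∃[ i ] c T (trail bits k) ≡ leaf i
      simple   : ∀ {t t′} → t < suc k → t′ < suc k → trail bits t ≡ trail bits t′ → t ≡ t′

  trail⇒path : ∀ {k bits} → SimpleLeafTrail k bits → SimpleLeafPath T k
  trail⇒path {k} {bits} simpleTrail = record
    { v = trail bits ∘ toℕ
    ; starts = refl
    ; steps = λ j → subst (λ t → IsBranch (c T (trail bits t))) (sym (FinP.toℕ-inject₁ j)) (branches (FinP.toℕ<n j))
                  , bits (toℕ j) , cong (λ t → δ T (trail bits t) (bits (toℕ j))) (FinP.toℕ-inject₁ j)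
    ; endsLeaf = subst (λ t → ∃[ i ] c T (trail bits t) ≡ leaf i) (sym (FinP.toℕ-fromℕ k)) endsLeaf
    ; simple = λ a b → FinP.toℕ-injective ∘ simple (FinP.toℕ<n a) (FinP.toℕ<n b)
    }
    where open SimpleLeafTrail simpleTrail

  stream : ∀ {k} → Vec Bool k → ℕ → Bool
  stream [] t = false
  stream (b ∷ bs) zero = b
  stream (b ∷ bs) (suc t) = stream bs t

  stream-tabulate : ∀ {k} (f : Fin k → Bool) (j : Fin k) → stream (tabulate f) (toℕ j) ≡ f j
  stream-tabulate f Fin.zero = refl
  stream-tabulate f (Fin.suc j) = stream-tabulate (f ∘ Fin.suc) j

  path⇒trail : ∀ {k} → SimpleLeafPath T k → ∃[ bs ] SimpleLeafTrail k (stream bs)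
  path⇒trail {k} path = bs , record
    { branches = λ t<k → subst (IsBranch ∘ c T) (sym (trail≡v′ t<k)) (proj₁ (steps (fromℕ< t<k)))
    ; endsLeaf = subst (λ x → ∃[ i ] c T x ≡ leaf i) (sym (trans (cong (trail (stream bs)) (sym (FinP.toℕ-fromℕ k))) (trail≡v (fromℕ k)))) endsLeaf
    ; simple = λ t<k t′<k eq → trans (sym (FinP.toℕ-fromℕ< t<k)) (trans
        (cong toℕ (simple _ _ (trans (sym (trail≡v″ t<k)) (trans eq (trail≡v″ t′<k))))) (FinP.toℕ-fromℕ< t′<k))
    }
    where
    open SimpleLeafPath path
    bs = tabulate (λ j → proj₁ (proj₂ (steps j)))
    trail≡v : ∀ a → trail (stream bs) (toℕ a) ≡ v a
    trail≡v = <-weakInduction (λ a → trail (stream bs) (toℕ a) ≡ v a) (sym starts) λ j trail≡vj → begin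
      δ T (trail (stream bs) (toℕ j)) (stream bs (toℕ j))
        ≡⟨ cong₂ (δ T) (trans (cong (trail (stream bs)) (sym (FinP.toℕ-inject₁ j))) trail≡vj)
                        (stream-tabulate (λ j → proj₁ (proj₂ (steps j))) j) ⟩
      δ T (v (inject₁ j)) (proj₁ (proj₂ (steps j)))   ≡⟨ proj₂ (proj₂ (steps j)) ⟩
      v (Fin.suc j)                                     ∎
      where open ≡-Reasoning
    trail≡v″ : ∀ {t} (t<k : t < suc k) → trail (stream bs) t ≡ v (fromℕ< t<k)
    trail≡v″ t<k = trans (cong (trail (stream bs)) (sym (FinP.toℕ-fromℕ< t<k))) (trail≡v (fromℕ< t<k))
    trail≡v′ : ∀ {t} (t<k : t < k) → trail (stream bs) t ≡ v (inject₁ (fromℕ< t<k))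
    trail≡v′ {t} t<k = trans (cong (trail (stream bs)) (sym (trans (FinP.toℕ-inject₁ _) (FinP.toℕ-fromℕ< t<k))))
                             (trail≡v (inject₁ (fromℕ< t<k)))

module _ {m n : ℕ} (T : DDG (Fin m) n) where

  simpleLeafTrail? : ∀ k bits → Dec (SimpleLeafTrail T k bits)
  simpleLeafTrail? k bits = map′
    (λ (b , l , s) → record { branches = λ {t} → b {t} ; endsLeaf = l ; simple = λ {t} {t′} t<k t′<k → s {t} t<k {t′} t′<k })
    (λ r → let open SimpleLeafTrail r in (λ {t} → branches {t}) , endsLeaf , λ {t} t<k {t′} t′<k → simple {t} {t′} t<k t′<k)
    (ℕP.allUpTo? (λ t → isBranch? (c T (at t))) k
      ×-dec isLeaf? (c T (at k))
      ×-dec ℕP.allUpTo? (λ t → ℕP.allUpTo? (λ t′ → (at t FinP.≟ at t′) →-dec (t ℕP.≟ t′)) (suc k)) (suc k))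
    where
    at = trail T bits
    isBranch? : (l : Label n) → Dec (IsBranch l)
    isBranch? branch = yes isBranch
    isBranch? (leaf i) = no λ ()
    isLeaf? : (l : Label n) → Dec (∃[ i ] l ≡ leaf i)
    isLeaf? branch = no λ ()
    isLeaf? (leaf i) = yes (i , refl)

  -- bit strings of length k are enumerated as the subsets of Fin k
  simpleLeafPath? : ∀ k → Dec (SimpleLeafPath T k)
  simpleLeafPath? k = map′ (trail⇒path T ∘ proj₂) (path⇒trail T) (anySubset? (simpleLeafTrail? k ∘ stream T))

largest : ∀ {P : ℕ → Set} → Decidable P → ∀ B → (∀ k → P k → k ≤ B) → ∀ {k₀} → P k₀ →
  ∃[ k ] P k × (∀ k′ → P k′ → k′ ≤ k)
largest {P} P? B bounded Pk₀ with P? B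
... | yes PB = B , PB , bounded
largest {P} P? zero bounded Pk₀ | no ¬PB = ⊥-elim (¬PB (subst P (ℕP.n≤0⇒n≡0 (bounded _ Pk₀)) Pk₀))
largest {P} P? (suc B) bounded Pk₀ | no ¬PB = largest P? B bounded′ Pk₀
  where
  bounded′ : ∀ k → P k → k ≤ B
  bounded′ k Pk with ℕP.m≤n⇒m<n∨m≡n (bounded k Pk)
  ... | inj₁ k<1+B = ℕP.≤-pred k<1+B
  ... | inj₂ refl = ⊥-elim (¬PB Pk)

usesPrecision : ∀ {m n} (T : DDG (Fin m) n) B → (∀ k → SimpleLeafPath T k → k ≤ B) → ∀ {k₀} → SimpleLeafPath T k₀ →
  ∃[ k ] k ≤ B × UsesPrecision T k
usesPrecision T B bounded path₀ with largest (simpleLeafPath? T) B bounded path₀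
... | k , path , maximal = k , bounded k path , path , maximal

module Realisation {N : Set} {n m : ℕ} (T : DDG N n) (Valid : N → Set)
  (valid-root : Valid (root T)) (valid-δ : ∀ {x} b → Valid x → Valid (δ T x b))
  (enc : N → Fin m) (dec : Fin m → N) (dec-enc : ∀ {x} → Valid x → dec (enc x) ≡ x) where

  realised : DDG (Fin m) n
  realised = record { root = enc (root T) ; c = c T ∘ dec ; δ = λ y b → enc (δ T (dec y) b) }

  c-realised : ∀ {x} → Valid x → c realised (enc x) ≡ c T x
  c-realised = cong (c T) ∘ dec-enc

  walk-realised : ∀ {x} → Valid x → ∀ w → walk realised (enc x) w ≡ walk T x w
  walk-realised {x} valid w with leaf-or-branch T x
  ... | inj₁ (j , cx) = trans (walk-leaf realised w (trans (c-realised valid) cx)) (sym (walk-leaf T w cx))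
  walk-realised {x} valid [] | inj₂ cx = trans (walk-[] realised (trans (c-realised valid) cx)) (sym (walk-[] T cx))
  walk-realised {x} valid (b ∷ w) | inj₂ cx = begin
    walk realised (enc x) (b ∷ w)            ≡⟨ walk-branch realised b w (trans (c-realised valid) cx) ⟩
    walk realised (enc (δ T (dec (enc x)) b)) w ≡⟨ cong (λ y → walk realised (enc (δ T y b)) w) (dec-enc valid) ⟩
    walk realised (enc (δ T x b)) w          ≡⟨ walk-realised (valid-δ b valid) w ⟩
    walk T (δ T x b) w                       ≡⟨ sym (walk-branch T b w cx) ⟩
    walk T x (b ∷ w)                         ∎
    where open ≡-Reasoning

  haltCount-realised : ∀ i k → haltCount realised i k ≡ haltCount T i k
  haltCount-realised i k = count-cong k (cong (isHalt i) ∘ walk-realised valid-root)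

  valid-trail : ∀ bits t → Valid (trail T bits t)
  valid-trail bits zero = valid-root
  valid-trail bits (suc t) = valid-δ (bits t) (valid-trail bits t)

  trail-realised : ∀ bits t → trail realised bits t ≡ enc (trail T bits t)
  trail-realised bits zero = refl
  trail-realised bits (suc t) = cong (λ y → enc (δ T y (bits t)))
    (trans (cong dec (trail-realised bits t)) (dec-enc (valid-trail bits t)))

  c-trail-realised : ∀ bits t → c realised (trail realised bits t) ≡ c T (trail T bits t)
  c-trail-realised bits t = trans (cong (c realised) (trail-realised bits t)) (c-realised (valid-trail bits t))

  simpleLeafTrail-unrealise : ∀ {k bits} → SimpleLeafTrail realised k bits → SimpleLeafTrail T k bits
  simpleLeafTrail-unrealise {k} {bits} simpleTrail = record
    { branches = λ {t} t<k → subst IsBranch (c-trail-realised bits t) (branches t<k)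
    ; endsLeaf = proj₁ endsLeaf , trans (sym (c-trail-realised bits k)) (proj₂ endsLeaf)
    ; simple = λ {t} {t′} t<k t′<k eq →
        simple t<k t′<k (trans (trail-realised bits t) (trans (cong enc eq) (sym (trail-realised bits t′))))
    }
    where open SimpleLeafTrail simpleTrail

  simpleLeafTrail-realise : ∀ {k bits} → SimpleLeafTrail T k bits → SimpleLeafTrail realised k bits
  simpleLeafTrail-realise {k} {bits} simpleTrail = record
    { branches = λ {t} t<k → subst IsBranch (sym (c-trail-realised bits t)) (branches t<k)
    ; endsLeaf = proj₁ endsLeaf , trans (c-trail-realised bits k) (proj₂ endsLeaf)
    ; simple = λ {t} {t′} t<k t′<k eq → simple t<k t′<k (begin
        trail T bits t              ≡⟨ sym (dec-enc (valid-trail bits t)) ⟩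
        dec (enc (trail T bits t))  ≡⟨ cong dec (trans (sym (trail-realised bits t)) (trans eq (trail-realised bits t′))) ⟩
        dec (enc (trail T bits t′)) ≡⟨ dec-enc (valid-trail bits t′) ⟩
        trail T bits t′             ∎)
    }
    where
    open SimpleLeafTrail simpleTrail
    open ≡-Reasoning

  realised-usesPrecision : ∀ B → (∀ k bits → SimpleLeafTrail T k bits → k ≤ B) →
    ∀ {k₀ bits₀} → SimpleLeafTrail T k₀ bits₀ → ∃[ k ] k ≤ B × UsesPrecision realised k
  realised-usesPrecision B bounded trail₀ = usesPrecision realised B
    (λ k path → bounded k _ (simpleLeafTrail-unrealise (proj₂ (path⇒trail realised path))))
    (trail⇒path realised (simpleLeafTrail-realise trail₀))

-- The construction

ExactOptimalSampler : ∀ {n} (M : Fin n → ℕ) .{{_ : NonZero (total M)}} → ℕ → Set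
ExactOptimalSampler {n} M B = ∃[ m ] Σ (DDG (Fin m) n) λ T →
  ExactFor T (target M) × EntropyOptimal T (target M) × ∃[ k ] (k ≤ B × UsesPrecision T k)

toℕ-mod : ∀ {a b} .{{_ : NonZero b}} → a < b → toℕ (a mod b) ≡ a
toℕ-mod {a} {b} a<b = trans (FinP.toℕ-fromℕ< (ℕ.m%n<n a b)) (ℕ.m<n⇒m%n≡m a<b)

firstFailure : ∀ {P : ℕ → Set} → Decidable P → P 0 → ∀ N → ¬ P N → ∃[ d ] (∀ {e} → e ≤ d → P e) × ¬ P (suc d)
firstFailure P? P0 zero ¬P0 = ⊥-elim (¬P0 P0)
firstFailure P? P0 (suc N) ¬PN with P? 1
... | no ¬P1 = 0 , (λ { z≤n → P0 }) , ¬P1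
... | yes P1 with firstFailure (P? ∘ suc) P1 N ¬PN
...   | d , upto , ¬P = suc d , (λ { z≤n → P0 ; (s≤s e≤d) → upto e≤d }) , ¬P

bit : Bool → ℕ
bit true = 1
bit false = 0

module Construction {n : ℕ} (M : Fin (suc n) → ℕ) .{{_ : NonZero (total M)}}
                    (s T : ℕ) (1≤T : 1 ≤ T) (Z∣2^s[2^T∸1] : total M ∣ 2 ^ s * (2 ^ T ∸ 1)) where

  Z : ℕ
  Z = total M

  L : ℕ
  L = s + T

  quot rem : Fin (suc n) → ℕ → ℕ
  quot i ℓ = (2 ^ ℓ * M i) / Z
  rem i ℓ = (2 ^ ℓ * M i) % Z

  -- after ℓ bits a floor sampler is still running on 2^ℓ - Σ quot strings: the branch nodes of level ℓ
  width : ℕ → ℕ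
  width ℓ = 2 ^ ℓ ∸ ∑[ i < suc n ] quot i ℓ

  2^ℓ*Z≡ : ∀ ℓ → 2 ^ ℓ * Z ≡ ∑[ i < suc n ] rem i ℓ + (∑[ i < suc n ] quot i ℓ) * Z
  2^ℓ*Z≡ ℓ = begin
    2 ^ ℓ * Z                                         ≡⟨ cong (2 ^ ℓ *_) (total≡∑ M) ⟩
    2 ^ ℓ * ∑[ i < suc n ] M i                        ≡⟨ *-distribˡ-sum (2 ^ ℓ) M ⟩
    ∑[ i < suc n ] (2 ^ ℓ * M i)                      ≡⟨ sum-cong-≗ (λ i → ℕ.m≡m%n+[m/n]*n (2 ^ ℓ * M i) Z) ⟩
    ∑[ i < suc n ] (rem i ℓ + quot i ℓ * Z)           ≡⟨ ∑-distrib-+ (λ i → rem i ℓ) (λ i → quot i ℓ * Z) ⟩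
    ∑[ i < suc n ] rem i ℓ + ∑[ i < suc n ] (quot i ℓ * Z)
      ≡⟨ cong (∑[ i < suc n ] rem i ℓ +_) (sym (*-distribʳ-sum Z (λ i → quot i ℓ))) ⟩
    ∑[ i < suc n ] rem i ℓ + (∑[ i < suc n ] quot i ℓ) * Z ∎
    where open ≡-Reasoning

  Z*width≡∑rem : ∀ ℓ → Z * width ℓ ≡ ∑[ i < suc n ] rem i ℓ
  Z*width≡∑rem ℓ = begin
    Z * (2 ^ ℓ ∸ ∑q)                     ≡⟨ ℕP.*-distribˡ-∸ Z (2 ^ ℓ) ∑q ⟩
    Z * 2 ^ ℓ ∸ Z * ∑q                   ≡⟨ cong₂ _∸_ (trans (ℕP.*-comm Z (2 ^ ℓ)) (2^ℓ*Z≡ ℓ)) (ℕP.*-comm Z ∑q) ⟩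
    ∑[ i < suc n ] rem i ℓ + ∑q * Z ∸ ∑q * Z ≡⟨ ℕP.m+n∸n≡m _ (∑q * Z) ⟩
    ∑[ i < suc n ] rem i ℓ               ∎
    where
    open ≡-Reasoning
    ∑q = ∑[ i < suc n ] quot i ℓ

  width≤1+n : ∀ ℓ → width ℓ ≤ suc n
  width≤1+n ℓ = ℕP.*-cancelˡ-≤ Z (begin
    Z * width ℓ                   ≡⟨ Z*width≡∑rem ℓ ⟩
    ∑[ i < suc n ] rem i ℓ        ≤⟨ ∑-mono-≤ (λ i → ℕP.<⇒≤ (ℕ.m%n<n (2 ^ ℓ * M i) Z)) ⟩
    ∑[ i < suc n ] Z              ≡⟨ trans (∑-const (suc n) Z) (ℕP.*-comm (suc n) Z) ⟩
    Z * suc n                     ∎)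
    where open ℕP.≤-Reasoning

  width≤2^ : ∀ ℓ → width ℓ ≤ 2 ^ ℓ
  width≤2^ ℓ = ℕP.m∸n≤m (2 ^ ℓ) (∑[ i < suc n ] quot i ℓ)

  rem-period : ∀ x → (2 ^ L * x) % Z ≡ (2 ^ s * x) % Z
  rem-period x = begin
    (2 ^ (s + T) * x) % Z                              ≡⟨ cong (λ t → (t * x) % Z) (ℕP.^-distribˡ-+-* 2 s T) ⟩
    (2 ^ s * 2 ^ T * x) % Z
      ≡⟨ cong (λ t → (2 ^ s * t * x) % Z) (sym (ℕP.m+[n∸m]≡n {1} {2 ^ T} (ℕP.m^n>0 2 T))) ⟩
    (2 ^ s * (1 + (2 ^ T ∸ 1)) * x) % Z                 ≡⟨ cong (_% Z) (expand (2 ^ s) (2 ^ T ∸ 1)) ⟩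
    (2 ^ s * x + 2 ^ s * (2 ^ T ∸ 1) * x) % Z           ≡⟨ ℕ.%-remove-+ʳ (2 ^ s * x) (∣m⇒∣m*n x Z∣2^s[2^T∸1]) ⟩
    (2 ^ s * x) % Z                                     ∎
    where
    open ≡-Reasoning
    expand : ∀ a b → a * (1 + b) * x ≡ a * x + a * b * x
    expand a b = trans (cong (_* x) (ℕP.*-distribˡ-+ a 1 b))
                  (trans (ℕP.*-distribʳ-+ x (a * 1) (a * b)) (cong (λ t → t * x + a * b * x) (ℕP.*-identityʳ a)))

  s<L : s < L
  s<L = subst (_≤ s + T) (ℕP.+-comm s 1) (ℕP.+-monoʳ-≤ s 1≤T)

  -- levels 0, …, L - 1, where level L is identified with level s
  next : ℕ → ℕ
  next ℓ with suc ℓ ℕP.<? L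
  ... | yes _ = suc ℓ
  ... | no _ = s

  next<L : ∀ ℓ → next ℓ < L
  next<L ℓ with suc ℓ ℕP.<? L
  ... | yes 1+ℓ<L = 1+ℓ<L
  ... | no _ = s<L

  next-suc : ∀ {ℓ} → suc ℓ < L → next ℓ ≡ suc ℓ
  next-suc {ℓ} 1+ℓ<L with suc ℓ ℕP.<? L
  ... | yes _ = refl
  ... | no 1+ℓ≮L = ⊥-elim (1+ℓ≮L 1+ℓ<L)

  next-wrap : ∀ {ℓ} → suc ℓ ≡ L → next ℓ ≡ s
  next-wrap {ℓ} 1+ℓ≡L with suc ℓ ℕP.<? L
  ... | yes 1+ℓ<L = ⊥-elim (ℕP.<-irrefl 1+ℓ≡L 1+ℓ<L)
  ... | no _ = refl

  rem-suc : ∀ i ℓ → rem i (suc ℓ) ≡ (2 * rem i ℓ) % Z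
  rem-suc i ℓ = begin
    (2 * 2 ^ ℓ * M i) % Z             ≡⟨ cong (_% Z) (ℕP.*-assoc 2 (2 ^ ℓ) (M i)) ⟩
    (2 * x) % Z                       ≡⟨ ℕ.%-distribˡ-* 2 x Z ⟩
    ((2 % Z) * (x % Z)) % Z           ≡⟨ cong (λ t → ((2 % Z) * t) % Z) (sym (ℕ.m%n%n≡m%n x Z)) ⟩
    ((2 % Z) * (x % Z % Z)) % Z       ≡⟨ sym (ℕ.%-distribˡ-* 2 (x % Z) Z) ⟩
    (2 * rem i ℓ) % Z                 ∎
    where
    open ≡-Reasoning
    x = 2 ^ ℓ * M i

  rem-next : ∀ i {ℓ} → ℓ < L → rem i (next ℓ) ≡ (2 * rem i ℓ) % Z
  rem-next i {ℓ} ℓ<L with suc ℓ ℕP.<? L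
  ... | yes _ = rem-suc i ℓ
  ... | no 1+ℓ≮L = begin
    rem i s             ≡⟨ sym (rem-period (M i)) ⟩
    rem i L             ≡⟨ cong (rem i) (sym (ℕP.≤-antisym ℓ<L (ℕP.≮⇒≥ 1+ℓ≮L))) ⟩
    rem i (suc ℓ)       ≡⟨ rem-suc i ℓ ⟩
    (2 * rem i ℓ) % Z   ∎
    where open ≡-Reasoning

  leaves : ℕ → Fin (suc n) → ℕ
  leaves ℓ i = (2 * rem i ℓ) / Z

  2*rem≡ : ∀ i {ℓ} → ℓ < L → 2 * rem i ℓ ≡ rem i (next ℓ) + leaves ℓ i * Z
  2*rem≡ i {ℓ} ℓ<L = trans (ℕ.m≡m%n+[m/n]*n (2 * rem i ℓ) Z) (cong (_+ leaves ℓ i * Z) (sym (rem-next i ℓ<L)))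

  2*width≡ : ∀ {ℓ} → ℓ < L → 2 * width ℓ ≡ width (next ℓ) + ∑[ i < suc n ] leaves ℓ i
  2*width≡ {ℓ} ℓ<L = ℕP.*-cancelˡ-≡ (2 * width ℓ) _ Z (begin
    Z * (2 * width ℓ)                   ≡⟨ trans (ℕP.*-comm Z (2 * width ℓ)) (ℕP.*-assoc 2 (width ℓ) Z) ⟩
    2 * (width ℓ * Z)                   ≡⟨ cong (2 *_) (trans (ℕP.*-comm (width ℓ) Z) (Z*width≡∑rem ℓ)) ⟩
    2 * ∑[ i < suc n ] rem i ℓ          ≡⟨ *-distribˡ-sum 2 (λ i → rem i ℓ) ⟩
    ∑[ i < suc n ] (2 * rem i ℓ)        ≡⟨ sum-cong-≗ (λ i → 2*rem≡ i ℓ<L) ⟩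
    ∑[ i < suc n ] (rem i (next ℓ) + leaves ℓ i * Z)
      ≡⟨ ∑-distrib-+ (λ i → rem i (next ℓ)) (λ i → leaves ℓ i * Z) ⟩
    ∑[ i < suc n ] rem i (next ℓ) + ∑[ i < suc n ] (leaves ℓ i * Z)
      ≡⟨ cong₂ _+_ (sym (Z*width≡∑rem (next ℓ))) (sym (*-distribʳ-sum Z (leaves ℓ))) ⟩
    Z * width (next ℓ) + (∑[ i < suc n ] leaves ℓ i) * Z
      ≡⟨ trans (cong (Z * width (next ℓ) +_) (ℕP.*-comm _ Z)) (sym (ℕP.*-distribˡ-+ Z (width (next ℓ)) _)) ⟩
    Z * (width (next ℓ) + ∑[ i < suc n ] leaves ℓ i) ∎)
    where open ≡-Reasoning

  data Node : Set where
    branchNode : ℕ → ℕ → Node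
    leafNode : Fin (suc n) → Node

  -- the children of the branch nodes of level ℓ, numbered 0, …, 2 width ℓ - 1: first the branch nodes of
  -- the next level, then the leaves, leaves ℓ i of them labelled i
  child : ℕ → ℕ → Node
  child ℓ x with x ℕP.<? width (next ℓ)
  ... | yes _ = branchNode (next ℓ) x
  ... | no _ = leafNode (block (leaves ℓ) (x ∸ width (next ℓ)))

  child-branch : ∀ ℓ {x} → x < width (next ℓ) → child ℓ x ≡ branchNode (next ℓ) x
  child-branch ℓ {x} x<w with x ℕP.<? width (next ℓ)
  ... | yes _ = refl
  ... | no x≮w = ⊥-elim (x≮w x<w)

  child-leaf : ∀ ℓ t → child ℓ (width (next ℓ) + t) ≡ leafNode (block (leaves ℓ) t)
  child-leaf ℓ t with width (next ℓ) + t ℕP.<? width (next ℓ)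
  ... | yes w+t<w = ⊥-elim (ℕP.m+n≮m (width (next ℓ)) t w+t<w)
  ... | no _ = cong (leafNode ∘ block (leaves ℓ)) (ℕP.m+n∸m≡n (width (next ℓ)) t)

  label : Node → Label (suc n)
  label (branchNode _ _) = branch
  label (leafNode i) = leaf i

  step : Node → Bool → Node
  step (branchNode ℓ j) b = child ℓ (bit b + 2 * j)
  step (leafNode i) b = leafNode i

  tree : DDG Node (suc n)
  tree = record { root = branchNode 0 0 ; c = label ; δ = step }

  child-isBranch⇒<width : ∀ ℓ x → IsBranch (label (child ℓ x)) → x < width (next ℓ)
  child-isBranch⇒<width ℓ x isBranch-child with x ℕP.<? width (next ℓ)
  ... | yes x<w = x<w

  child-≮width⇒leaf : ∀ ℓ {x} → ¬ x < width (next ℓ) → ∃[ i ] child ℓ x ≡ leafNode i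
  child-≮width⇒leaf ℓ {x} x≮w with x ℕP.<? width (next ℓ)
  ... | yes x<w = ⊥-elim (x≮w x<w)
  ... | no _ = _ , refl

  branch≢leaf : ∀ {ℓ j i} → branchNode ℓ j ≢ leafNode i
  branch≢leaf ()

  branchNode-injectiveʳ : ∀ {ℓ j ℓ′ j′} → branchNode ℓ j ≡ branchNode ℓ′ j′ → j ≡ j′
  branchNode-injectiveʳ refl = refl

  haltCount-level : ∀ d {ℓ} → ℓ < L → ∀ i →
    sumBelow (width ℓ) (λ j → countFrom tree (branchNode ℓ j) (isHalt i) d) ≡ (2 ^ d * rem i ℓ) / Z
  haltCount-level zero {ℓ} ℓ<L i = begin
    sumBelow (width ℓ) (λ j → countFrom tree (branchNode ℓ j) (isHalt i) 0)
      ≡⟨ sumBelow-cong (width ℓ) (λ {j} _ → countFrom-branch-0 tree {branchNode ℓ j} (isHalt i) refl) ⟩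
    sumBelow (width ℓ) (λ _ → 0)   ≡⟨ trans (sumBelow-const (width ℓ) 0) (ℕP.*-zeroʳ (width ℓ)) ⟩
    0                              ≡⟨ sym (ℕ.m<n⇒m/n≡0 (subst (_< Z) (sym (ℕP.*-identityˡ (rem i ℓ))) (ℕ.m%n<n (2 ^ ℓ * M i) Z))) ⟩
    (1 * rem i ℓ) / Z              ∎
    where open ≡-Reasoning
  haltCount-level (suc d) {ℓ} ℓ<L i = begin
    sumBelow (width ℓ) (λ j → countFrom tree (branchNode ℓ j) (isHalt i) (suc d))
      ≡⟨ sumBelow-cong (width ℓ) (λ {j} _ → trans (countFrom-branch tree (isHalt i) d refl) (ℕP.+-comm (h (child ℓ (suc (2 * j)))) _)) ⟩
    sumBelow (width ℓ) (λ j → h (child ℓ (2 * j)) + h (child ℓ (suc (2 * j))))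
      ≡⟨ sumBelow-pairs (width ℓ) (h ∘ child ℓ) ⟩
    sumBelow (2 * width ℓ) (h ∘ child ℓ)
      ≡⟨ trans (cong (λ N → sumBelow N (h ∘ child ℓ)) (2*width≡ ℓ<L)) (sumBelow-+ (width ℓ′) ∑leaves (h ∘ child ℓ)) ⟩
    sumBelow (width ℓ′) (h ∘ child ℓ) + sumBelow ∑leaves (h ∘ child ℓ ∘ (width ℓ′ +_))
      ≡⟨ cong₂ _+_ (sumBelow-cong (width ℓ′) (cong h ∘ child-branch ℓ))
                   (sumBelow-cong ∑leaves λ {t} _ → trans (cong h (child-leaf ℓ t)) (countFrom-leaf tree (isHalt i) d refl)) ⟩
    sumBelow (width ℓ′) (h ∘ branchNode ℓ′) + sumBelow ∑leaves (λ t → 2 ^ d * isHalt i (halted (block (leaves ℓ) t)))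
      ≡⟨ cong₂ _+_ (haltCount-level d (next<L ℓ) i)
                   (trans (sumBelow-*ˡ ∑leaves (2 ^ d) _) (cong (2 ^ d *_) (block-size (leaves ℓ) i))) ⟩
    (2 ^ d * rem i ℓ′) / Z + 2 ^ d * leaves ℓ i
      ≡⟨ sym (trans (ℕ.+-distrib-/-∣ʳ (2 ^ d * rem i ℓ′) (n∣m*n (2 ^ d * leaves ℓ i)))
                    (cong ((2 ^ d * rem i ℓ′) / Z +_) (ℕ.m*n/n≡m (2 ^ d * leaves ℓ i) Z))) ⟩
    (2 ^ d * rem i ℓ′ + 2 ^ d * leaves ℓ i * Z) / Z
      ≡⟨ cong (_/ Z) (sym 2^[1+d]*rem≡) ⟩
    (2 ^ suc d * rem i ℓ) / Z ∎
    where
    open ≡-Reasoning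
    ℓ′ = next ℓ
    ∑leaves = ∑[ i < suc n ] leaves ℓ i
    h : Node → ℕ
    h x = countFrom tree x (isHalt i) d
    2^[1+d]*rem≡ : 2 ^ suc d * rem i ℓ ≡ 2 ^ d * rem i ℓ′ + 2 ^ d * leaves ℓ i * Z
    2^[1+d]*rem≡ = begin
      2 * 2 ^ d * rem i ℓ                     ≡⟨ trans (cong (_* rem i ℓ) (ℕP.*-comm 2 (2 ^ d))) (ℕP.*-assoc (2 ^ d) 2 (rem i ℓ)) ⟩
      2 ^ d * (2 * rem i ℓ)                   ≡⟨ cong (2 ^ d *_) (2*rem≡ i ℓ<L) ⟩
      2 ^ d * (rem i ℓ′ + leaves ℓ i * Z)     ≡⟨ ℕP.*-distribˡ-+ (2 ^ d) (rem i ℓ′) (leaves ℓ i * Z) ⟩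
      2 ^ d * rem i ℓ′ + 2 ^ d * (leaves ℓ i * Z) ≡⟨ cong (2 ^ d * rem i ℓ′ +_) (sym (ℕP.*-assoc (2 ^ d) (leaves ℓ i) Z)) ⟩
      2 ^ d * rem i ℓ′ + 2 ^ d * leaves ℓ i * Z ∎

  Valid : Node → Set
  Valid (branchNode ℓ j) = ℓ < L × j < width ℓ
  Valid (leafNode _) = ⊤

  valid-child : ∀ ℓ x → Valid (child ℓ x)
  valid-child ℓ x with x ℕP.<? width (next ℓ)
  ... | yes x<w = next<L ℓ , x<w
  ... | no _ = tt

  valid-step : ∀ {x} b → Valid x → Valid (step x b)
  valid-step {branchNode ℓ j} b _ = valid-child ℓ (bit b + 2 * j)
  valid-step {leafNode i} b _ = tt

  instance
    L-nonZero : NonZero L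
    L-nonZero = ℕ.>-nonZero (ℕP.<-≤-trans (s≤s z≤n) s<L)

  -- branch nodes (ℓ, j) and leaves i are coded as ℓ (1 + n) + j and L (1 + n) + i
  encode : Node → Fin (L * suc n + suc n)
  encode (branchNode ℓ j) = combine (ℓ mod L) (j mod suc n) ↑ˡ suc n
  encode (leafNode i) = (L * suc n) ↑ʳ i

  decode : Fin (L * suc n + suc n) → Node
  decode y = [ (λ y′ → let ℓ , j = remQuot {L} (suc n) y′ in branchNode (toℕ ℓ) (toℕ j)) , leafNode ]′ (splitAt (L * suc n) y)

  decode-encode : ∀ {x} → Valid x → decode (encode x) ≡ x
  decode-encode {branchNode ℓ j} (ℓ<L , j<w) = begin
    decode (combine (ℓ mod L) (j mod suc n) ↑ˡ suc n)
      ≡⟨ cong [ _ , leafNode ]′ (FinP.splitAt-↑ˡ (L * suc n) (combine (ℓ mod L) (j mod suc n)) (suc n)) ⟩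
    (let ℓ′ , j′ = remQuot {L} (suc n) (combine (ℓ mod L) (j mod suc n)) in branchNode (toℕ ℓ′) (toℕ j′))
      ≡⟨ cong (λ (ℓ′ , j′) → branchNode (toℕ ℓ′) (toℕ j′)) (FinP.remQuot-combine (ℓ mod L) (j mod suc n)) ⟩
    branchNode (toℕ (ℓ mod L)) (toℕ (j mod suc n))
      ≡⟨ cong₂ branchNode (toℕ-mod ℓ<L) (toℕ-mod (ℕP.<-≤-trans j<w (width≤1+n ℓ))) ⟩
    branchNode ℓ j ∎
    where open ≡-Reasoning
  decode-encode {leafNode i} _ = cong [ _ , leafNode ]′ (FinP.splitAt-↑ʳ (L * suc n) (suc n) i)

  level : ℕ → ℕ
  level = fold 0 next

  fold-next-linear : ∀ {ℓ} t → ℓ + t < L → fold ℓ next t ≡ ℓ + t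
  fold-next-linear {ℓ} zero ℓ<L = sym (ℕP.+-identityʳ ℓ)
  fold-next-linear {ℓ} (suc t) ℓ+1+t<L = begin
    next (fold ℓ next t)   ≡⟨ cong next (fold-next-linear t (ℕP.<-trans (ℕP.+-monoʳ-< ℓ (ℕP.n<1+n t)) ℓ+1+t<L)) ⟩
    next (ℓ + t)           ≡⟨ next-suc (subst (_< L) (ℕP.+-suc ℓ t) ℓ+1+t<L) ⟩
    suc (ℓ + t)            ≡⟨ sym (ℕP.+-suc ℓ t) ⟩
    ℓ + suc t              ∎
    where open ≡-Reasoning

  fold-next-cycle : fold s next T ≡ s
  fold-next-cycle = begin
    fold s next T              ≡⟨ cong (fold s next) (sym 1+t≡T) ⟩
    next (fold s next t)       ≡⟨ cong next (fold-next-linear t (subst (s + t <_) s+1+t≡L (ℕP.+-monoʳ-< s (ℕP.n<1+n t)))) ⟩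
    next (s + t)               ≡⟨ next-wrap (trans (sym (ℕP.+-suc s t)) s+1+t≡L) ⟩
    s                          ∎
    where
    open ≡-Reasoning
    t = T ∸ 1
    1+t≡T : suc t ≡ T
    1+t≡T = ℕP.m+[n∸m]≡n 1≤T
    s+1+t≡L : s + suc t ≡ L
    s+1+t≡L = cong (s +_) 1+t≡T

  level-period : ∀ a → level (a * T + s) ≡ s
  level-period zero = fold-next-linear s s<L
  level-period (suc a) = begin
    fold 0 next (T + a * T + s)       ≡⟨ cong level (ℕP.+-assoc T (a * T) s) ⟩
    fold 0 next (T + (a * T + s))     ≡⟨ fold-+ 0 next T ⟩
    fold (level (a * T + s)) next T   ≡⟨ cong (λ ℓ → fold ℓ next T) (level-period a) ⟩
    fold s next T                     ≡⟨ fold-next-cycle ⟩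
    s                                 ∎
    where open ≡-Reasoning

  s+width-s*T≤Z∸1 : Z ≡ 2 ^ s ⊎ s + 2 ^ s * T < Z → s + width s * T ≤ Z ∸ 1
  s+width-s*T≤Z∸1 (inj₁ Z≡2^s) = subst (_≤ Z ∸ 1) (sym s+0≡s) (subst (λ z → s ≤ z ∸ 1) (sym Z≡2^s) (ℕP.<⇒≤pred (n<2^n s)))
    where
    rem-s≡0 : ∀ i → rem i s ≡ 0
    rem-s≡0 i = n∣m⇒m%n≡0 (2 ^ s * M i) Z (subst (_∣ 2 ^ s * M i) (sym Z≡2^s) (m∣m*n (M i)))
    width-s≡0 : width s ≡ 0
    width-s≡0 = ℕP.*-cancelˡ-≡ (width s) 0 Z (trans (Z*width≡∑rem s)
      (trans (sum-cong-≗ rem-s≡0) (trans (sum-replicate-zero (suc n)) (sym (ℕP.*-zeroʳ Z)))))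
    s+0≡s : s + width s * T ≡ s
    s+0≡s = trans (cong (λ w → s + w * T) width-s≡0) (ℕP.+-identityʳ s)
  s+width-s*T≤Z∸1 (inj₂ s+2^s*T<Z) = ℕP.<⇒≤pred (ℕP.≤-<-trans (ℕP.+-monoʳ-≤ s (ℕP.*-monoˡ-≤ T (width≤2^ s))) s+2^s*T<Z)

  module _ (M<Z : ∀ i → M i < Z) where

    width-0 : width 0 ≡ 1
    width-0 = cong (1 ∸_) (trans (sum-cong-≗ λ i → ℕ.m<n⇒m/n≡0 (subst (_< Z) (sym (ℕP.*-identityˡ (M i))) (M<Z i)))
                                 (sum-replicate-zero (suc n)))

    rem-0 : ∀ i → rem i 0 ≡ M i
    rem-0 i = trans (cong (_% Z) (ℕP.*-identityˡ (M i))) (ℕ.m<n⇒m%n≡m (M<Z i))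

    0<width-0 : 0 < width 0
    0<width-0 = subst (0 <_) (sym width-0) (s≤s z≤n)

    floorCounts : FloorCounts M tree
    floorCounts i k = begin
      sumBelow 1 (λ j → countFrom tree (branchNode 0 j) (isHalt i) k)
        ≡⟨ cong (λ N → sumBelow N (λ j → countFrom tree (branchNode 0 j) (isHalt i) k)) (sym width-0) ⟩
      sumBelow (width 0) (λ j → countFrom tree (branchNode 0 j) (isHalt i) k) ≡⟨ haltCount-level k (ℕP.≤-<-trans z≤n s<L) i ⟩
      (2 ^ k * rem i 0) / Z                                                  ≡⟨ cong (λ r → (2 ^ k * r) / Z) (rem-0 i) ⟩
      (2 ^ k * M i) / Z                                                      ∎
      where open ≡-Reasoning

    open Realisation tree Valid (ℕP.≤-<-trans z≤n s<L , 0<width-0) valid-step encode decode decode-encode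

    branch-at : ∀ {k} bits → (∀ {t} → t < k → IsBranch (label (trail tree bits t))) →
      ∀ {t} → t < k → ∃[ j ] trail tree bits t ≡ branchNode (level t) j × j < width (level t)
    branch-at bits branches {zero} 0<k = 0 , refl , 0<width-0
    branch-at bits branches {suc t} 1+t<k =
      let j , trail≡ , j<w = branch-at bits branches (ℕP.<-trans (ℕP.n<1+n t) 1+t<k)
          x = bit (bits t) + 2 * j
          trail≡child : trail tree bits (suc t) ≡ child (level t) x
          trail≡child = cong (λ y → step y (bits t)) trail≡
          x<w = child-isBranch⇒<width (level t) x (subst (IsBranch ∘ label) trail≡child (branches 1+t<k))
      in x , trans trail≡child (child-branch (level t) x<w) , x<w

    -- a simple trail meets level s at the positions s, s + T, s + 2T, …, in distinct branch nodes
    simpleLeafTrail-length : ∀ k bits → SimpleLeafTrail tree k bits → k ≤ s + width s * T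
    simpleLeafTrail-length k bits simpleTrail with k ℕP.≤? s + width s * T
    ... | yes k≤ = k≤
    ... | no k≰ = ⊥-elim (FinP.<-irrefl (FinP.toℕ-injective a≡a′) a<a′)
      where
      open SimpleLeafTrail simpleTrail
      position : ℕ → ℕ
      position a = a * T + s
      position<k : ∀ {a} → a ≤ width s → position a < k
      position<k a≤w = ℕP.≤-<-trans (ℕP.≤-trans (ℕP.+-monoˡ-≤ s (ℕP.*-monoˡ-≤ T a≤w)) (ℕP.≤-reflexive (ℕP.+-comm _ s)))
                                    (ℕP.≰⇒> k≰)
      node : (a : Fin (suc (width s))) → ∃[ j ] trail tree bits (position (toℕ a)) ≡ branchNode s j × j < width s
      node a = let j , trail≡ , j<w = branch-at bits branches (position<k (ℕP.≤-pred (FinP.toℕ<n a))) in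
        j , trans trail≡ (cong (λ ℓ → branchNode ℓ j) (level-period (toℕ a))) ,
        subst (λ ℓ → j < width ℓ) (level-period (toℕ a)) j<w
      collision = FinP.pigeonhole (ℕP.n<1+n (width s)) (λ a → Fin.fromℕ< (proj₂ (proj₂ (node a))))
      a = proj₁ collision
      a′ = proj₁ (proj₂ collision)
      a<a′ = proj₁ (proj₂ (proj₂ collision))
      same-slot : proj₁ (node a) ≡ proj₁ (node a′)
      same-slot = trans (sym (FinP.toℕ-fromℕ< _)) (trans (cong toℕ (proj₂ (proj₂ (proj₂ collision)))) (FinP.toℕ-fromℕ< _))
      same-node : trail tree bits (position (toℕ a)) ≡ trail tree bits (position (toℕ a′))
      same-node = trans (proj₁ (proj₂ (node a))) (trans (cong (branchNode s) same-slot) (sym (proj₁ (proj₂ (node a′)))))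
      a≡a′ : toℕ a ≡ toℕ a′
      a≡a′ = ℕP.*-cancelʳ-≡ (toℕ a) (toℕ a′) T {{ℕ.>-nonZero 1≤T}} (ℕP.+-cancelʳ-≡ s (toℕ a * T) (toℕ a′ * T)
        (simple (ℕP.<-≤-trans (position<k (ℕP.≤-pred (FinP.toℕ<n a))) (ℕP.n≤1+n k))
                (ℕP.<-≤-trans (position<k (ℕP.≤-pred (FinP.toℕ<n a′))) (ℕP.n≤1+n k)) same-node))

    -- the all-ones trail runs through the nodes with the largest index of each level until it falls off
    ones = λ (_ : ℕ) → true

    module OnesTrail (d : ℕ) (fits : ∀ {e} → e ≤ d → 2 ^ e ∸ 1 < width (level e))
                     (¬fits : ¬ 2 ^ suc d ∸ 1 < width (level (suc d))) where

      ones-branch : ∀ {e} → e ≤ d → trail tree ones e ≡ branchNode (level e) (2 ^ e ∸ 1)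
      ones-branch {zero} _ = refl
      ones-branch {suc e} 1+e≤d = begin
        step (trail tree ones e) true                  ≡⟨ cong (λ y → step y true) (ones-branch (ℕP.<⇒≤ 1+e≤d)) ⟩
        child (level e) (1 + 2 * (2 ^ e ∸ 1))          ≡⟨ cong (child (level e)) (1+2*[2^e∸1]≡2^[1+e]∸1 e) ⟩
        child (level e) (2 ^ suc e ∸ 1)                ≡⟨ child-branch (level e) (fits 1+e≤d) ⟩
        branchNode (level (suc e)) (2 ^ suc e ∸ 1)     ∎
        where open ≡-Reasoning

      ones-leaf : ∃[ i ] trail tree ones (suc d) ≡ leafNode i
      ones-leaf = let i , child≡leaf = child-≮width⇒leaf (level d) ¬fits in
        i , trans (cong (λ y → step y true) (ones-branch ℕP.≤-refl))
                  (trans (cong (child (level d)) (1+2*[2^e∸1]≡2^[1+e]∸1 d)) child≡leaf)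

      ones-simple : ∀ {t t′} → t < suc (suc d) → t′ < suc (suc d) → trail tree ones t ≡ trail tree ones t′ → t ≡ t′
      ones-simple {t} {t′} t≤1+d t′≤1+d eq with ℕP.m≤n⇒m<n∨m≡n (ℕP.≤-pred t≤1+d) | ℕP.m≤n⇒m<n∨m≡n (ℕP.≤-pred t′≤1+d)
      ... | inj₁ t≤d | inj₁ t′≤d =
        2^∸1-injective (branchNode-injectiveʳ (trans (sym (ones-branch (ℕP.≤-pred t≤d))) (trans eq (ones-branch (ℕP.≤-pred t′≤d)))))
      ... | inj₁ t≤d | inj₂ refl = ⊥-elim (branch≢leaf (trans (sym (ones-branch (ℕP.≤-pred t≤d))) (trans eq (proj₂ ones-leaf))))
      ... | inj₂ refl | inj₁ t′≤d = ⊥-elim (branch≢leaf (trans (sym (ones-branch (ℕP.≤-pred t′≤d))) (trans (sym eq) (proj₂ ones-leaf))))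
      ... | inj₂ refl | inj₂ refl = refl

      ones-simpleLeafTrail : SimpleLeafTrail tree (suc d) ones
      ones-simpleLeafTrail = record
        { branches = λ t<1+d → subst (IsBranch ∘ label) (sym (ones-branch (ℕP.≤-pred t<1+d))) isBranch
        ; endsLeaf = proj₁ ones-leaf , cong label (proj₂ ones-leaf)
        ; simple = ones-simple
        }

    onesTrail : ∃[ k ] SimpleLeafTrail tree k ones
    onesTrail with firstFailure (λ e → 2 ^ e ∸ 1 ℕP.<? width (level e)) 0<width-0 (suc n) overflow
      where
      overflow : ¬ 2 ^ suc n ∸ 1 < width (level (suc n))
      overflow 2^∸1<w = ℕP.<-irrefl refl (ℕP.<-≤-trans 2^∸1<w (ℕP.≤-trans (width≤1+n (level (suc n))) (ℕP.<⇒≤pred (n<2^n (suc n)))))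
    ... | d , fits , ¬fits = suc d , OnesTrail.ones-simpleLeafTrail d fits ¬fits

    exactOptimalSampler : Z ≡ 2 ^ s ⊎ s + 2 ^ s * T < Z → ExactOptimalSampler M (Z ∸ 1)
    exactOptimalSampler Z-shape = L * suc n + suc n , realised ,
      floor⇒exact M realised floorCounts-realised , floor⇒optimal M realised floorCounts-realised ,
      realised-usesPrecision (Z ∸ 1)
        (λ k bits simpleTrail → ℕP.≤-trans (simpleLeafTrail-length k bits simpleTrail) (s+width-s*T≤Z∸1 Z-shape))
        (proj₂ onesTrail)
      where
      floorCounts-realised : FloorCounts M realised
      floorCounts-realised i k = trans (haltCount-realised i k) (floorCounts i k)

entry<total : ∀ {n} (M : Fin (suc (suc n)) → ℕ) → (∀ i → 0 < M i) → ∀ i → M i < total M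
entry<total M M>0 i = begin-strict
  M i                            <⟨ ℕP.m<m+n (M i) (ℕP.<-≤-trans (M>0 _) (ℕP.m≤m+n _ _)) ⟩
  M i + sum (removeAt M i)       ≡⟨ sym (trans (total≡∑ M) (sum-remove {i = i} M)) ⟩
  total M                        ∎
  where open ℕP.≤-Reasoning

singleLeafSampler : (M : Fin 1 → ℕ) .{{_ : NonZero (total M)}} → ExactOptimalSampler M (total M ∸ 1)
singleLeafSampler M = 1 , leafTree , floor⇒exact M leafTree floor , floor⇒optimal M leafTree floor ,
  let k , k≤0 , precision = usesPrecision leafTree 0 bounded path in k , ℕP.≤-trans k≤0 z≤n , precision
  where
  leafTree : DDG (Fin 1) 1
  leafTree = record { root = Fin.zero ; c = λ _ → leaf Fin.zero ; δ = λ _ _ → Fin.zero }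
  floor : FloorCounts M leafTree
  floor Fin.zero k = begin
    haltCount leafTree Fin.zero k     ≡⟨ countFrom-leaf leafTree {Fin.zero} (isHalt Fin.zero) k refl ⟩
    2 ^ k * 1                         ≡⟨ sym (ℕ.m*n/n≡m (2 ^ k * 1) (total M)) ⟩
    2 ^ k * 1 * total M / total M     ≡⟨ cong (_/ total M) (trans (ℕP.*-assoc (2 ^ k) 1 (total M)) (cong (2 ^ k *_) (ℕP.*-identityˡ _))) ⟩
    2 ^ k * (M Fin.zero + 0) / total M ≡⟨ cong (λ x → 2 ^ k * x / total M) (ℕP.+-identityʳ (M Fin.zero)) ⟩
    2 ^ k * M Fin.zero / total M      ∎
    where open ≡-Reasoning
  bounded : ∀ k → SimpleLeafPath leafTree k → k ≤ 0
  bounded zero _ = z≤n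
  bounded (suc k) path with proj₁ (SimpleLeafPath.steps path Fin.zero)
  ... | ()
  path : SimpleLeafPath leafTree 0
  path = record { v = λ _ → Fin.zero ; starts = refl ; steps = λ () ; endsLeaf = Fin.zero , refl
                ; simple = λ { Fin.zero Fin.zero _ → refl } }

theorem3p5 : ∀ (n : ℕ) (M : Fin n → ℕ) → (∀ i → 0 < M i) → .{{_ : NonZero (total M)}} →
    ∃[ m ] Σ (DDG (Fin m) n) (λ T →
      ExactFor T (target M) × EntropyOptimal T (target M) ×
      ∃[ k ] (k ≤ total M ∸ 1 × UsesPrecision T k))
theorem3p5 zero M M>0 {{Z≢0}} = ⊥-elim (ℕ.≢-nonZero⁻¹ (total M) {{Z≢0}} refl)
theorem3p5 (suc zero) M M>0 = singleLeafSampler M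
theorem3p5 (suc (suc n)) M M>0 =
  let s , T , 1≤T , Z∣2^s[2^T∸1] , Z-shape = periodOfTwo (total M) in
  Construction.exactOptimalSampler M s T 1≤T Z∣2^s[2^T∸1] (entry<total M M>0) Z-shape
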